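{- Let $n$ be a positive integer. For every polynomial $F$ in the variables $x_{ij}$ ($i,j\in[n]$) there is a constant $c_F\in\mathbb R$ with $\sum_{\sigma\in S_n}\sigma F\equiv_{(\mathcal Q_n,\deg F)}c_F$.
   Context: $x_{ij}$ corresponds to the edge between left vertex $i$ and right vertex $j$ of $K_{n,n}$; $\sigma\in S_n$ acts on polynomials only on the left labels, via the substitution $x_{ij}\mapsto x_{\sigma(i)j}$. $\mathcal Q_n=\{\sum_i x_{ij}-1: j\}\cup\{\sum_j x_{ij}-1: i\}\cup\{x_{ij}x_{il}: j\ne l\}\cup\{x_{ij}x_{lj}: i\ne l\}\cup\{x_{ij}^2-x_{ij}\}$. $F\equiv_{(\mathcal P,d)}G$ means there exist polynomials $q(p)$ with $F+\sum_p q(p)p=G$ and $\max_p\deg(q(p)p)\le d$. -}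

module Defs where

open import Level using (_⊔_)
open import Algebra.Bundles using (CommutativeRing)
open import Data.Nat as ℕ using (ℕ; zero; suc; _≤_; _<_)
open import Data.Fin as Fin using (Fin)
open import Data.Bool using (if_then_else_; _∧_)
open import Data.Vec as Vec using (Vec; lookup; tabulate; replicate)
open import Data.Vec.Properties using (≡-dec)
open import Data.List as List using (List; []; _∷_; _++_; map; concatMap; allFin; foldr; filter; length)
open import Data.List.Relation.Unary.AllPairs using (AllPairs; allPairs?)
open import Data.Product using (_×_; _,_; ∃)
open import Relation.Binary.PropositionalEquality using (_≡_; _≢_)
open import Relation.Binary.Definitions using (DecidableEquality)
open import Relation.Nullary using (¬?; does)

-- Monomials in the n² variables x_{ij} (i = left vertex, j = right vertex):
-- an exponent matrix e with e[i][j] = exponent of x_{ij}.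

Mon : ℕ → Set
Mon n = Vec (Vec ℕ n) n

_≟ᴹ_ : ∀ {n} → DecidableEquality (Mon n)
_≟ᴹ_ = ≡-dec (≡-dec ℕ._≟_)

zeroMon : ∀ {n} → Mon n
zeroMon = replicate _ (replicate _ 0)

_·ᴹ_ : ∀ {n} → Mon n → Mon n → Mon n
e ·ᴹ f = Vec.zipWith (Vec.zipWith ℕ._+_) e f

varMon : ∀ {n} → Fin n → Fin n → Mon n
varMon i j = tabulate λ k → tabulate λ l →
  if does (k Fin.≟ i) ∧ does (l Fin.≟ j) then 1 else 0

totalDeg : ∀ {n} → Mon n → ℕ
totalDeg e = Vec.sum (Vec.map Vec.sum e)

-- The symmetric group S_n, enumerated as the list of injective
-- (hence bijective) maps σ : [n] → [n], given by the vector (σ(0),…,σ(n-1)).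

allVecs : (n k : ℕ) → List (Vec (Fin n) k)
allVecs n zero    = Vec.[] ∷ []
allVecs n (suc k) = concatMap (λ i → map (i Vec.∷_) (allVecs n k)) (allFin n)

Sym : (n : ℕ) → List (Vec (Fin n) n)
Sym n = filter (λ v → allPairs? (λ a b → ¬? (a Fin.≟ b)) (Vec.toList v)) (allVecs n n)

-- Substitution x_{ij} ↦ x_{σ(i) j} on a monomial:
-- the new exponent of x_{kj} is Σ_{i : σ(i) = k} e[i][j].
renameMon : ∀ {n} → Vec (Fin n) n → Mon n → Mon n
renameMon {n} σ e = tabulate λ k → tabulate λ j →
  Vec.sum (tabulate {n = n} λ i →
    if does (lookup σ i Fin.≟ k) then lookup (lookup e i) j else 0)

-- Polynomials with coefficients in a commutative ring R,
-- represented as finite formal sums of terms (coefficient , monomial);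
-- two representations are equal iff all coefficients agree.

module _ {c ℓ} (R : CommutativeRing c ℓ) where
  open CommutativeRing R

  Poly : ℕ → Set c
  Poly n = List (Carrier × Mon n)

  coeff : ∀ {n} → Poly n → Mon n → Carrier
  coeff [] m = 0#
  coeff ((a , e) ∷ p) m = if does (e ≟ᴹ m) then a + coeff p m else coeff p m

  _≈ₚ_ : ∀ {n} → Poly n → Poly n → Set ℓ
  p ≈ₚ q = ∀ m → coeff p m ≈ coeff q m

  _+ₚ_ : ∀ {n} → Poly n → Poly n → Poly n
  p +ₚ q = p ++ q

  -ₚ_ : ∀ {n} → Poly n → Poly n
  -ₚ p = map (λ { (a , e) → (- a , e) }) p

  _*ₚ_ : ∀ {n} → Poly n → Poly n → Poly n
  p *ₚ q = concatMap (λ { (a , e) → map (λ { (b , f) → (a * b , e ·ᴹ f) }) q }) p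

  constₚ : ∀ {n} → Carrier → Poly n
  constₚ a = (a , zeroMon) ∷ []

  x : ∀ {n} → Fin n → Fin n → Poly n
  x i j = (1# , varMon i j) ∷ []

  sumₚ : ∀ {n} → List (Poly n) → Poly n
  sumₚ = foldr _+ₚ_ []

  DegLE : ∀ {n} → Poly n → ℕ → Set ℓ
  DegLE p d = ∀ m → d < totalDeg m → coeff p m ≈ 0#

  -- deg p = d  (least d with deg p ≤ d; the zero polynomial gets degree 0)
  IsDegree : ∀ {n} → Poly n → ℕ → Set ℓ
  IsDegree p d = DegLE p d × (∀ e → DegLE p e → d ≤ e)

  act : ∀ {n} → Vec (Fin n) n → Poly n → Poly n
  act σ p = map (λ { (a , e) → (a , renameMon σ e) }) p

  symSum : ∀ {n} → Poly n → Poly n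
  symSum {n} F = sumₚ (map (λ σ → act σ F) (Sym n))

  Q : (n : ℕ) → List (Poly n)
  Q n =
       map (λ j → sumₚ (map (λ i → x i j) (allFin n)) +ₚ (-ₚ constₚ 1#)) (allFin n)
    ++ map (λ i → sumₚ (map (λ j → x i j) (allFin n)) +ₚ (-ₚ constₚ 1#)) (allFin n)
    ++ concatMap (λ i → concatMap (λ j → map (λ l → x i j *ₚ x i l)
         (filter (λ l → ¬? (j Fin.≟ l)) (allFin n))) (allFin n)) (allFin n)
    ++ concatMap (λ j → concatMap (λ i → map (λ l → x i j *ₚ x l j)
         (filter (λ l → ¬? (i Fin.≟ l)) (allFin n))) (allFin n)) (allFin n)
    ++ concatMap (λ i → map (λ j → (x i j *ₚ x i j) +ₚ (-ₚ x i j)) (allFin n)) (allFin n)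

  EquivMod : ∀ {n} → List (Poly n) → ℕ → Poly n → Poly n → Set (c ⊔ ℓ)
  EquivMod P d F G =
    ∃ λ (q : Fin (length P) → Poly _) →
      ((F +ₚ sumₚ (map (λ k → q k *ₚ List.lookup P k) (allFin (length P)))) ≈ₚ G)
      × (∀ k → DegLE (q k *ₚ List.lookup P k) d)

module Submission where

-- Write F as a sum of terms a·x^e and x^e as a word w of variables x_{ij}.
-- For an injective relabelling σ of the rows, the axioms x² = x,
-- x_{ij}x_{il} = 0 (j ≠ l) and x_{ij}x_{lj} = 0 (i ≠ l) reduce σ·w, in
-- degree |w|, either to 0 or to the product over a partial matching M of
-- rows to columns determined by w alone (WordReduction).  Summing the
-- product over M over all σ ∈ S_n gives (fillings M 0) times the sum over
-- distinct row labels of x_{τ₁c₁} ⋯ x_{τₖcₖ} (FreshSums); this is the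
-- product of the column sums Σ_i x_{icᵣ}, which equal 1 (MatchingSums).
-- Hence each term symmetrises to a constant in degree ≤ deg F, and so does
-- F, since the terms above deg F cancel (Symmetrisation).

open import Defs
open import Algebra.Bundles using (CommutativeRing)
open import Data.Nat using (ℕ; _≤_)
open import Data.Product using (∃)
open import Level using (_⊔_)
open import Algebra.Bundles using (CommutativeMonoid)
open import Data.Nat as ℕ using (zero; suc)
import Data.Nat.Properties as ℕP
open import Data.Fin as Fin using (Fin)
import Data.Fin.Properties as FinP
open import Data.Bool using (Bool; true; false; if_then_else_; _∧_)
open import Data.Maybe using (Maybe; just; nothing)
import Data.Maybe.Properties as MaybeP
open import Data.Product using (_,_; proj₁; proj₂)
open import Data.Sum using ([_,_]′)
open import Data.Empty using (⊥-elim)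
open import Data.Vec as Vec using (Vec; lookup; tabulate; toList; _[_]≔_)
import Data.Vec.Properties as VP
open import Data.List as List using (List; []; _∷_; _++_; map; concatMap; filter; length; allFin)
import Data.List.Properties as LP
open import Data.List.Membership.Propositional using (_∈_; _∉_; lose)
open import Data.List.Membership.Propositional.Properties
  using (∈-++⁺ˡ; ∈-++⁺ʳ; ∈-++⁻; ∈-map⁺; ∈-concatMap⁺; ∈-allFin; ∈-filter⁺; ∈-filter⁻)
open import Data.List.Relation.Unary.Any using (here; there)
import Data.List.Relation.Unary.Any as Any
import Data.List.Relation.Unary.Any.Properties as AnyP
open import Data.List.Relation.Unary.All as All using (All; all?)
import Data.List.Relation.Unary.All.Properties as AllP
open import Data.List.Relation.Unary.AllPairs as AP using (AllPairs; allPairs?)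
import Data.List.Relation.Unary.AllPairs.Properties as APP
open import Relation.Unary using (Pred; Decidable)
open import Relation.Nullary using (Dec; does; yes; no; ¬?; ¬_; _×-dec_)
open import Relation.Nullary.Decidable using (dec-true; dec-false; does-⇔)
open import Relation.Binary.PropositionalEquality as ≡ using (_≡_; _≢_)
open import Relation.Binary.Structures using (IsEquivalence)
open import Function using (_∘_; id; mk⇔)
open import Function.Definitions using (Injective)

module ListSums {a b} (M : CommutativeMonoid a b) where
  open CommutativeMonoid M
  open import Algebra.Properties.CommutativeSemigroup commutativeSemigroup public using (interchange)
  open import Algebra.Properties.CommutativeMonoid.Sum M public using (sum; sum-cong-≋; sum-replicate-zero; ∑-distrib-+)
  open import Algebra.Properties.Monoid.Mult monoid public using (_×_; ×-congʳ; ×-assocˡ)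

  sumL : ∀ {x} {X : Set x} → List X → (X → Carrier) → Carrier
  sumL [] f = ε
  sumL (y ∷ xs) f = f y ∙ sumL xs f

  ×-zero : ∀ k → k × ε ≈ ε
  ×-zero zero = refl
  ×-zero (suc k) = trans (identityˡ _) (×-zero k)

  module _ {x} {X : Set x} where
    sumL-cong∈ : ∀ (xs : List X) {f g} → (∀ y → y ∈ xs → f y ≈ g y) → sumL xs f ≈ sumL xs g
    sumL-cong∈ [] h = refl
    sumL-cong∈ (y ∷ xs) h = ∙-cong (h y (here ≡.refl)) (sumL-cong∈ xs (λ z z∈ → h z (there z∈)))

    sumL-cong : ∀ (xs : List X) {f g} → (∀ y → f y ≈ g y) → sumL xs f ≈ sumL xs g
    sumL-cong xs h = sumL-cong∈ xs (λ y _ → h y)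

    sumL-++ : ∀ (xs ys : List X) f → sumL (xs ++ ys) f ≈ sumL xs f ∙ sumL ys f
    sumL-++ [] ys f = sym (identityˡ _)
    sumL-++ (y ∷ xs) ys f = trans (∙-cong refl (sumL-++ xs ys f)) (sym (assoc _ _ _))

    sumL-zero : ∀ (xs : List X) → sumL xs (λ _ → ε) ≈ ε
    sumL-zero [] = refl
    sumL-zero (y ∷ xs) = trans (identityˡ _) (sumL-zero xs)

    sumL-∙ : ∀ (xs : List X) f g → sumL xs (λ y → f y ∙ g y) ≈ sumL xs f ∙ sumL xs g
    sumL-∙ [] f g = sym (identityˡ _)
    sumL-∙ (y ∷ xs) f g = trans (∙-cong refl (sumL-∙ xs f g)) (interchange _ _ _ _)

    sumL-if : ∀ (xs : List X) (c : Bool) f → sumL xs (λ y → if c then f y else ε) ≈ (if c then sumL xs f else ε)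
    sumL-if xs true f = refl
    sumL-if xs false f = sumL-zero xs

    sumL-× : ∀ (xs : List X) k f → sumL xs (λ y → k × f y) ≈ k × sumL xs f
    sumL-× xs zero f = sumL-zero xs
    sumL-× xs (suc k) f = trans (sumL-∙ xs f (λ y → k × f y)) (∙-cong refl (sumL-× xs k f))

    sumL-filter : ∀ {p} {P : Pred X p} (P? : Decidable P) (xs : List X) f →
      sumL (filter P? xs) f ≈ sumL xs (λ y → if does (P? y) then f y else ε)
    sumL-filter P? [] f = refl
    sumL-filter P? (y ∷ xs) f with does (P? y)
    ... | true = ∙-cong refl (sumL-filter P? xs f)
    ... | false = trans (sumL-filter P? xs f) (sym (identityˡ _))

    sumL-partition : ∀ {p} {P : Pred X p} (P? : Decidable P) (xs : List X) f →
      sumL xs f ≈ sumL (filter P? xs) f ∙ sumL (filter (λ y → ¬? (P? y)) xs) f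
    sumL-partition P? [] f = sym (identityˡ _)
    sumL-partition P? (y ∷ xs) f with does (P? y)
    ... | true = trans (∙-cong refl (sumL-partition P? xs f)) (sym (assoc _ _ _))
    ... | false = trans (∙-cong refl (sumL-partition P? xs f))
                   (trans (sym (assoc _ _ _)) (trans (∙-cong (comm _ _) refl) (assoc _ _ _)))

    sumL-count : ∀ {p} {P : Pred X p} (P? : Decidable P) (xs : List X) y →
      sumL xs (λ z → if does (P? z) then y else ε) ≈ length (filter P? xs) × y
    sumL-count P? [] y = refl
    sumL-count P? (z ∷ xs) y with does (P? z)
    ... | true = ∙-cong refl (sumL-count P? xs y)
    ... | false = trans (identityˡ _) (sumL-count P? xs y)

  sumL-map : ∀ {x y} {X : Set x} {Y : Set y} (g : X → Y) (xs : List X) f → sumL (map g xs) f ≡ sumL xs (f ∘ g)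
  sumL-map g [] f = ≡.refl
  sumL-map g (z ∷ xs) f = ≡.cong (f (g z) ∙_) (sumL-map g xs f)

  sumL-concatMap : ∀ {x y} {X : Set x} {Y : Set y} (g : X → List Y) (xs : List X) (f : Y → Carrier) →
    sumL (concatMap g xs) f ≈ sumL xs (λ z → sumL (g z) f)
  sumL-concatMap g [] f = refl
  sumL-concatMap g (z ∷ xs) f = trans (sumL-++ (g z) (concatMap g xs) f) (∙-cong refl (sumL-concatMap g xs f))

  sumL-swap : ∀ {x y} {X : Set x} {Y : Set y} (xs : List X) (ys : List Y) (h : X → Y → Carrier) →
    sumL xs (λ u → sumL ys (λ v → h u v)) ≈ sumL ys (λ v → sumL xs (λ u → h u v))
  sumL-swap [] ys h = sym (sumL-zero ys)
  sumL-swap (u ∷ xs) ys h = trans (∙-cong refl (sumL-swap xs ys h)) (sym (sumL-∙ ys (h u) (λ v → sumL xs (λ u' → h u' v))))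

  sumL-tabulate : ∀ {x} {X : Set x} m (g : Fin m → X) (f : X → Carrier) → sumL (List.tabulate g) f ≡ sum (f ∘ g)
  sumL-tabulate zero g f = ≡.refl
  sumL-tabulate (suc m) g f = ≡.cong (f (g Fin.zero) ∙_) (sumL-tabulate m (g ∘ Fin.suc) f)

  sum-delta : ∀ m (k : Fin m) (f : Fin m → Carrier) → sum (λ i → if does (i Fin.≟ k) then f i else ε) ≈ f k
  sum-delta (suc m) Fin.zero f = trans (∙-cong refl (sum-replicate-zero m)) (identityʳ _)
  sum-delta (suc m) (Fin.suc k) f = trans (identityˡ _) (sum-delta m k (f ∘ Fin.suc))

  sumL-delta : ∀ m (k : Fin m) (f : Fin m → Carrier) → sumL (allFin m) (λ i → if does (i Fin.≟ k) then f i else ε) ≈ f k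
  sumL-delta m k f = trans (reflexive (sumL-tabulate m id _)) (sum-delta m k f)

module Monomials (n : ℕ) where
  open import Data.Product using (_×_)
  module N = ListSums ℕP.+-0-commutativeMonoid

  ent : Mon n → Fin n → Fin n → ℕ
  ent e k l = lookup (lookup e k) l

  monExt : ∀ {e f : Mon n} → (∀ k l → ent e k l ≡ ent f k l) → e ≡ f
  monExt {e} {f} h = vecExt (λ k → vecExt (h k))
    where
    vecExt : ∀ {a} {A : Set a} {xs ys : Vec A n} → (∀ i → lookup xs i ≡ lookup ys i) → xs ≡ ys
    vecExt {xs = xs} {ys} h =
      ≡.trans (≡.sym (VP.tabulate∘lookup xs)) (≡.trans (VP.tabulate-cong h) (VP.tabulate∘lookup ys))

  ent-· : ∀ (e f : Mon n) k l → ent (e ·ᴹ f) k l ≡ ent e k l ℕ.+ ent f k l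
  ent-· e f k l = ≡.trans (≡.cong (λ v → lookup v l) (VP.lookup-zipWith _ k e f))
                          (VP.lookup-zipWith _ l (lookup e k) (lookup f k))

  ent-0 : ∀ k l → ent (zeroMon {n}) k l ≡ 0
  ent-0 k l = ≡.trans (≡.cong (λ v → lookup v l) (VP.lookup-replicate k _)) (VP.lookup-replicate l 0)

  ent-var : ∀ i j k l → ent (varMon {n} i j) k l ≡ (if does (k Fin.≟ i) ∧ does (l Fin.≟ j) then 1 else 0)
  ent-var i j k l = ≡.trans (≡.cong (λ v → lookup v l) (VP.lookup∘tabulate _ k)) (VP.lookup∘tabulate _ l)

  ·ᴹ-comm : ∀ (e f : Mon n) → e ·ᴹ f ≡ f ·ᴹ e
  ·ᴹ-comm e f = monExt λ k l →
    ≡.trans (ent-· e f k l) (≡.trans (ℕP.+-comm (ent e k l) (ent f k l)) (≡.sym (ent-· f e k l)))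

  ·ᴹ-assoc : ∀ (e f g : Mon n) → (e ·ᴹ f) ·ᴹ g ≡ e ·ᴹ (f ·ᴹ g)
  ·ᴹ-assoc e f g = monExt λ k l → begin
      ent ((e ·ᴹ f) ·ᴹ g) k l                 ≡⟨ ent-· (e ·ᴹ f) g k l ⟩
      ent (e ·ᴹ f) k l ℕ.+ ent g k l          ≡⟨ ≡.cong (ℕ._+ ent g k l) (ent-· e f k l) ⟩
      (ent e k l ℕ.+ ent f k l) ℕ.+ ent g k l ≡⟨ ℕP.+-assoc (ent e k l) (ent f k l) (ent g k l) ⟩
      ent e k l ℕ.+ (ent f k l ℕ.+ ent g k l) ≡⟨ ≡.cong (ent e k l ℕ.+_) (≡.sym (ent-· f g k l)) ⟩
      ent e k l ℕ.+ ent (f ·ᴹ g) k l          ≡⟨ ≡.sym (ent-· e (f ·ᴹ g) k l) ⟩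
      ent (e ·ᴹ (f ·ᴹ g)) k l                 ∎
    where open ≡.≡-Reasoning

  ·ᴹ-identityˡ : ∀ (e : Mon n) → zeroMon ·ᴹ e ≡ e
  ·ᴹ-identityˡ e = monExt λ k l → ≡.trans (ent-· zeroMon e k l) (≡.cong (ℕ._+ ent e k l) (ent-0 k l))

  -- Division of monomials: if e · f = m then f = m / e (entrywise truncated subtraction).
  _∸ᴹ_ : Mon n → Mon n → Mon n
  m ∸ᴹ e = Vec.zipWith (Vec.zipWith ℕ._∸_) m e

  ·ᴹ-cancel : ∀ {e f m : Mon n} → e ·ᴹ f ≡ m → f ≡ m ∸ᴹ e
  ·ᴹ-cancel {e} {f} {m} ≡.refl = monExt λ k l → ≡.sym (begin
      ent ((e ·ᴹ f) ∸ᴹ e) k l              ≡⟨ ≡.trans (≡.cong (λ v → lookup v l) (VP.lookup-zipWith _ k (e ·ᴹ f) e))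
                                                       (VP.lookup-zipWith _ l (lookup (e ·ᴹ f) k) (lookup e k)) ⟩
      ent (e ·ᴹ f) k l ℕ.∸ ent e k l        ≡⟨ ≡.cong (ℕ._∸ ent e k l) (ent-· e f k l) ⟩
      (ent e k l ℕ.+ ent f k l) ℕ.∸ ent e k l ≡⟨ ℕP.m+n∸m≡n (ent e k l) (ent f k l) ⟩
      ent f k l                              ∎)
    where open ≡.≡-Reasoning

  vecSum : ∀ {k} (v : Vec ℕ k) → Vec.sum v ≡ N.sum (lookup v)
  vecSum Vec.[] = ≡.refl
  vecSum (a Vec.∷ v) = ≡.cong (a ℕ.+_) (vecSum v)

  totalDeg-ent : ∀ (e : Mon n) → totalDeg e ≡ N.sum (λ k → N.sum (λ l → ent e k l))
  totalDeg-ent e = ≡.trans (vecSum (Vec.map Vec.sum e))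
                           (N.sum-cong-≋ (λ k → ≡.trans (VP.lookup-map k Vec.sum e) (vecSum (lookup e k))))

  totalDeg-· : ∀ (e f : Mon n) → totalDeg (e ·ᴹ f) ≡ totalDeg e ℕ.+ totalDeg f
  totalDeg-· e f = begin
      totalDeg (e ·ᴹ f)
        ≡⟨ totalDeg-ent (e ·ᴹ f) ⟩
      N.sum (λ k → N.sum (λ l → ent (e ·ᴹ f) k l))
        ≡⟨ N.sum-cong-≋ (λ k → ≡.trans (N.sum-cong-≋ (ent-· e f k)) (N.∑-distrib-+ (ent e k) (ent f k))) ⟩
      N.sum (λ k → N.sum (ent e k) ℕ.+ N.sum (ent f k))
        ≡⟨ N.∑-distrib-+ (λ k → N.sum (ent e k)) (λ k → N.sum (ent f k)) ⟩
      N.sum (λ k → N.sum (ent e k)) ℕ.+ N.sum (λ k → N.sum (ent f k))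
        ≡⟨ ≡.sym (≡.cong₂ ℕ._+_ (totalDeg-ent e) (totalDeg-ent f)) ⟩
      totalDeg e ℕ.+ totalDeg f ∎
    where open ≡.≡-Reasoning

  totalDeg-0 : totalDeg (zeroMon {n}) ≡ 0
  totalDeg-0 = ≡.trans (totalDeg-ent zeroMon)
    (≡.trans (N.sum-cong-≋ (λ k → ≡.trans (N.sum-cong-≋ (ent-0 k)) (N.sum-replicate-zero n))) (N.sum-replicate-zero n))

  totalDeg-var : ∀ i j → totalDeg (varMon {n} i j) ≡ 1
  totalDeg-var i j = ≡.trans (totalDeg-ent (varMon i j))
    (≡.trans (N.sum-cong-≋ row) (N.sum-delta n i (λ _ → 1)))
    where
    ∧-if : ∀ a b → (if a ∧ b then 1 else 0) ≡ (if a then (if b then 1 else 0) else 0)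
    ∧-if true b = ≡.refl
    ∧-if false b = ≡.refl
    if-sum : ∀ (a : Bool) (f : Fin n → ℕ) → N.sum (λ l → if a then f l else 0) ≡ (if a then N.sum f else 0)
    if-sum true f = ≡.refl
    if-sum false f = N.sum-replicate-zero n
    row : ∀ k → N.sum (ent (varMon i j) k) ≡ (if does (k Fin.≟ i) then 1 else 0)
    row k = ≡.trans (N.sum-cong-≋ (λ l → ≡.trans (ent-var i j k l) (∧-if (does (k Fin.≟ i)) (does (l Fin.≟ j)))))
      (≡.trans (if-sum (does (k Fin.≟ i)) _)
               (≡.cong (λ z → if does (k Fin.≟ i) then z else 0) (N.sum-delta n j (λ _ → 1))))

  rename-ent : ∀ (σ : Vec (Fin n) n) (e : Mon n) k j →
    ent (renameMon σ e) k j ≡ N.sum (λ i → if does (lookup σ i Fin.≟ k) then ent e i j else 0)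
  rename-ent σ e k j =
    ≡.trans (≡.cong (λ v → lookup v j) (VP.lookup∘tabulate _ k))
    (≡.trans (VP.lookup∘tabulate _ j)
    (≡.trans (vecSum (tabulate {n = n} (λ i → if does (lookup σ i Fin.≟ k) then ent e i j else 0)))
             (N.sum-cong-≋ {n} (λ i → VP.lookup∘tabulate _ i))))

  rename-· : ∀ σ (a b : Mon n) → renameMon σ (a ·ᴹ b) ≡ renameMon σ a ·ᴹ renameMon σ b
  rename-· σ a b = monExt λ k j → begin
      ent (renameMon σ (a ·ᴹ b)) k j
        ≡⟨ rename-ent σ (a ·ᴹ b) k j ⟩
      N.sum (λ i → if does (lookup σ i Fin.≟ k) then ent (a ·ᴹ b) i j else 0)
        ≡⟨ N.sum-cong-≋ (λ i → ≡.trans (≡.cong (if-then0 (does (lookup σ i Fin.≟ k))) (ent-· a b i j))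
                                        (if-+ (does (lookup σ i Fin.≟ k)) (ent a i j) (ent b i j))) ⟩
      N.sum (λ i → guarded a k j i ℕ.+ guarded b k j i)
        ≡⟨ N.∑-distrib-+ (guarded a k j) (guarded b k j) ⟩
      N.sum (guarded a k j) ℕ.+ N.sum (guarded b k j)
        ≡⟨ ≡.sym (≡.cong₂ ℕ._+_ (rename-ent σ a k j) (rename-ent σ b k j)) ⟩
      ent (renameMon σ a) k j ℕ.+ ent (renameMon σ b) k j
        ≡⟨ ≡.sym (ent-· (renameMon σ a) (renameMon σ b) k j) ⟩
      ent (renameMon σ a ·ᴹ renameMon σ b) k j ∎
    where
    open ≡.≡-Reasoning
    if-then0 : Bool → ℕ → ℕ
    if-then0 c z = if c then z else 0
    guarded : Mon n → Fin n → Fin n → Fin n → ℕ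
    guarded e k j i = if does (lookup σ i Fin.≟ k) then ent e i j else 0
    if-+ : ∀ (c : Bool) x y → (if c then x ℕ.+ y else 0) ≡ (if c then x else 0) ℕ.+ (if c then y else 0)
    if-+ true x y = ≡.refl
    if-+ false x y = ≡.refl

  rename-0 : ∀ σ → renameMon σ (zeroMon {n}) ≡ zeroMon
  rename-0 σ = monExt λ k j → ≡.trans (rename-ent σ zeroMon k j)
    (≡.trans (N.sum-cong-≋ (λ i → ≡.trans (≡.cong (λ z → if does (lookup σ i Fin.≟ k) then z else 0) (ent-0 i j))
                                           (if-0 (does (lookup σ i Fin.≟ k)))))
    (≡.trans (N.sum-replicate-zero n) (≡.sym (ent-0 k j))))
    where
    if-0 : ∀ (c : Bool) → (if c then 0 else 0) ≡ 0
    if-0 true = ≡.refl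
    if-0 false = ≡.refl

  rename-var : ∀ σ i j → renameMon σ (varMon {n} i j) ≡ varMon (lookup σ i) j
  rename-var σ i j = monExt λ k l → begin
      ent (renameMon σ (varMon i j)) k l
        ≡⟨ rename-ent σ (varMon i j) k l ⟩
      N.sum (λ i′ → if does (lookup σ i′ Fin.≟ k) then ent (varMon i j) i′ l else 0)
        ≡⟨ N.sum-cong-≋ (λ i′ → ≡.trans (≡.cong (λ z → if does (lookup σ i′ Fin.≟ k) then z else 0) (ent-var i j i′ l))
                                         (swap-if (does (lookup σ i′ Fin.≟ k)) (does (i′ Fin.≟ i)) (does (l Fin.≟ j)))) ⟩
      N.sum (λ i′ → if does (i′ Fin.≟ i) then (if does (lookup σ i′ Fin.≟ k) ∧ does (l Fin.≟ j) then 1 else 0) else 0)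
        ≡⟨ N.sum-delta n i (λ i′ → if does (lookup σ i′ Fin.≟ k) ∧ does (l Fin.≟ j) then 1 else 0) ⟩
      (if does (lookup σ i Fin.≟ k) ∧ does (l Fin.≟ j) then 1 else 0)
        ≡⟨ ≡.cong (λ z → if z ∧ does (l Fin.≟ j) then 1 else 0)
                  (does-⇔ (mk⇔ ≡.sym ≡.sym) (lookup σ i Fin.≟ k) (k Fin.≟ lookup σ i)) ⟩
      (if does (k Fin.≟ lookup σ i) ∧ does (l Fin.≟ j) then 1 else 0)
        ≡⟨ ≡.sym (ent-var (lookup σ i) j k l) ⟩
      ent (varMon (lookup σ i) j) k l ∎
    where
    open ≡.≡-Reasoning
    swap-if : ∀ (a b c : Bool) → (if a then (if b ∧ c then 1 else 0) else 0) ≡ (if b then (if a ∧ c then 1 else 0) else 0)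
    swap-if true true c = ≡.refl
    swap-if true false c = ≡.refl
    swap-if false true c = ≡.refl
    swap-if false false c = ≡.refl

  Word : Set
  Word = List (Fin n × Fin n)

  ⟦_⟧ : Word → Mon n
  ⟦ [] ⟧ = zeroMon
  ⟦ (i , j) ∷ w ⟧ = varMon i j ·ᴹ ⟦ w ⟧

  renameWord : Vec (Fin n) n → Word → Word
  renameWord σ = List.map (λ p → (lookup σ (proj₁ p) , proj₂ p))

  rename-⟦⟧ : ∀ σ w → renameMon σ ⟦ w ⟧ ≡ ⟦ renameWord σ w ⟧
  rename-⟦⟧ σ [] = rename-0 σ
  rename-⟦⟧ σ ((i , j) ∷ w) = ≡.trans (rename-· σ (varMon i j) ⟦ w ⟧) (≡.cong₂ _·ᴹ_ (rename-var σ i j) (rename-⟦⟧ σ w))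

  totalDeg-⟦⟧ : ∀ w → totalDeg ⟦ w ⟧ ≡ length w
  totalDeg-⟦⟧ [] = totalDeg-0
  totalDeg-⟦⟧ ((i , j) ∷ w) = ≡.trans (totalDeg-· (varMon i j) ⟦ w ⟧) (≡.cong₂ ℕ._+_ (totalDeg-var i j) (totalDeg-⟦⟧ w))

  word : Mon n → Word
  word e = concatMap (λ i → concatMap (λ j → List.replicate (ent e i j) (i , j)) (allFin n)) (allFin n)

  word-⟦⟧ : ∀ e → ⟦ word e ⟧ ≡ e
  word-⟦⟧ e = monExt λ k l → begin
      ent ⟦ word e ⟧ k l
        ≡⟨ ent-⟦⟧ (word e) k l ⟩
      N.sumL (word e) (λ p → ent (varMon (proj₁ p) (proj₂ p)) k l)
        ≡⟨ N.sumL-concatMap _ (allFin n) _ ⟩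
      N.sumL (allFin n) (λ i → N.sumL (concatMap (λ j → List.replicate (ent e i j) (i , j)) (allFin n)) _)
        ≡⟨ N.sumL-cong (allFin n) (λ i → ≡.trans (N.sumL-concatMap _ (allFin n) _)
              (N.sumL-cong (allFin n) (λ j → ≡.trans (sumL-replicate (ent e i j) (i , j) _)
                 (≡.trans (≡.cong (ent e i j N.×_) (ent-var i j k l)) (×-indicator (ent e i j) (does (k Fin.≟ i)) (does (l Fin.≟ j))))))) ⟩
      N.sumL (allFin n) (λ i → N.sumL (allFin n) (λ j → if does (k Fin.≟ i) then (if does (l Fin.≟ j) then ent e i j else 0) else 0))
        ≡⟨ N.sumL-cong (allFin n) (λ i → N.sumL-if (allFin n) (does (k Fin.≟ i)) (λ j → if does (l Fin.≟ j) then ent e i j else 0)) ⟩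
      N.sumL (allFin n) (λ i → if does (k Fin.≟ i) then N.sumL (allFin n) (λ j → if does (l Fin.≟ j) then ent e i j else 0) else 0)
        ≡⟨ sumL-delta′ k (λ i → N.sumL (allFin n) (λ j → if does (l Fin.≟ j) then ent e i j else 0)) ⟩
      N.sumL (allFin n) (λ j → if does (l Fin.≟ j) then ent e k j else 0)
        ≡⟨ sumL-delta′ l (ent e k) ⟩
      ent e k l ∎
    where
    open ≡.≡-Reasoning
    ent-⟦⟧ : ∀ w k l → ent ⟦ w ⟧ k l ≡ N.sumL w (λ p → ent (varMon (proj₁ p) (proj₂ p)) k l)
    ent-⟦⟧ [] k l = ent-0 k l
    ent-⟦⟧ ((i , j) ∷ w) k l = ≡.trans (ent-· (varMon i j) ⟦ w ⟧ k l) (≡.cong (ent (varMon i j) k l ℕ.+_) (ent-⟦⟧ w k l))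
    sumL-replicate : ∀ {A : Set} m (p : A) f → N.sumL (List.replicate m p) f ≡ m N.× f p
    sumL-replicate zero p f = ≡.refl
    sumL-replicate (suc m) p f = ≡.cong (f p ℕ.+_) (sumL-replicate m p f)
    ×-indicator : ∀ m (a b : Bool) → m N.× (if a ∧ b then 1 else 0) ≡ (if a then (if b then m else 0) else 0)
    ×-indicator zero true true = ≡.refl
    ×-indicator (suc m) true true = ≡.cong suc (×-indicator m true true)
    ×-indicator m true false = N.×-zero m
    ×-indicator m false b = N.×-zero m
    sumL-delta′ : ∀ (k : Fin n) (f : Fin n → ℕ) → N.sumL (allFin n) (λ i → if does (k Fin.≟ i) then f i else 0) ≡ f k
    sumL-delta′ k f = ≡.trans (N.sumL-cong (allFin n) (λ i → ≡.cong (λ z → if z then f i else 0)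
                                 (does-⇔ (mk⇔ ≡.sym ≡.sym) (k Fin.≟ i) (i Fin.≟ k))))
                              (N.sumL-delta n k f)

  length-word : ∀ e → length (word e) ≡ totalDeg e
  length-word e = ≡.trans (≡.sym (totalDeg-⟦⟧ (word e))) (≡.cong totalDeg (word-⟦⟧ e))

module Polynomials {c ℓ} (R : CommutativeRing c ℓ) (n : ℕ) where
  open import Data.Product using (_×_)
  open CommutativeRing R
  open Monomials n
  open import Relation.Binary.Reasoning.Setoid setoid
  open import Algebra.Properties.Ring ring using (-‿+-comm; -0#≈0#; -‿distribˡ-*)
  module C = ListSums +-commutativeMonoid

  Pl : Set c
  Pl = Poly R n

  Term : Set c
  Term = Carrier × Mon n

  -- Coefficientwise equality, wrapped in a record so that the two
  -- polynomials can be inferred from a proof.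
  infix 4 _≈P_
  record _≈P_ (p q : Pl) : Set ℓ where
    constructor ⟪_⟫
    field coeffs : ∀ m → coeff R p m ≈ coeff R q m
  open _≈P_ public

  termCoeff : Term → Mon n → Carrier
  termCoeff (a , e) m = if does (e ≟ᴹ m) then a else 0#

  termCoeff-≢ : ∀ a {e m} → ¬ e ≡ m → termCoeff (a , e) m ≡ 0#
  termCoeff-≢ a {e} {m} e≢m rewrite dec-false (e ≟ᴹ m) e≢m = ≡.refl

  termCoeff-≡ : ∀ a e → termCoeff (a , e) e ≡ a
  termCoeff-≡ a e rewrite dec-true (e ≟ᴹ e) ≡.refl = ≡.refl

  termCoeff-cong : ∀ {a b} e m → a ≈ b → termCoeff (a , e) m ≈ termCoeff (b , e) m
  termCoeff-cong e m a≈b with does (e ≟ᴹ m)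
  ... | true = a≈b
  ... | false = refl

  termCoeff-mon : ∀ a {e f} m → e ≡ f → termCoeff (a , e) m ≡ termCoeff (a , f) m
  termCoeff-mon a m ≡.refl = ≡.refl

  termCoeff-neg : ∀ a e m → termCoeff (- a , e) m ≈ - termCoeff (a , e) m
  termCoeff-neg a e m with does (e ≟ᴹ m)
  ... | true = refl
  ... | false = sym -0#≈0#

  termCoeff-*ˡ : ∀ a b e m → termCoeff (a * b , e) m ≈ a * termCoeff (b , e) m
  termCoeff-*ˡ a b e m with does (e ≟ᴹ m)
  ... | true = refl
  ... | false = sym (zeroʳ a)

  coeff-sum : ∀ (p : Pl) m → coeff R p m ≈ C.sumL p (λ t → termCoeff t m)
  coeff-sum [] m = refl
  coeff-sum ((a , e) ∷ p) m with does (e ≟ᴹ m)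
  ... | true = +-cong refl (coeff-sum p m)
  ... | false = trans (coeff-sum p m) (sym (+-identityˡ _))

  coeff-++ : ∀ (p q : Pl) m → coeff R (p ++ q) m ≈ coeff R p m + coeff R q m
  coeff-++ p q m = trans (coeff-sum (p ++ q) m) (trans (C.sumL-++ p q _) (sym (+-cong (coeff-sum p m) (coeff-sum q m))))

  ≈P-isEquivalence : IsEquivalence _≈P_
  ≈P-isEquivalence = record
    { refl = ⟪ (λ m → refl) ⟫
    ; sym = λ p≈q → ⟪ (λ m → sym (coeffs p≈q m)) ⟫
    ; trans = λ p≈q q≈r → ⟪ (λ m → trans (coeffs p≈q m) (coeffs q≈r m)) ⟫ }

  +P-commutativeMonoid : CommutativeMonoid c ℓ
  +P-commutativeMonoid = record
    { Carrier = Pl ; _≈_ = _≈P_ ; _∙_ = _++_ ; ε = []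
    ; isCommutativeMonoid = record
      { isMonoid = record
        { isSemigroup = record
          { isMagma = record
            { isEquivalence = ≈P-isEquivalence
            ; ∙-cong = λ {p} {p′} {q} {q′} p≈p′ q≈q′ → ⟪ (λ m →
                trans (coeff-++ p q m) (trans (+-cong (coeffs p≈p′ m) (coeffs q≈q′ m)) (sym (coeff-++ p′ q′ m)))) ⟫ }
          ; assoc = λ p q r → ⟪ (λ m → reflexive (≡.cong (λ z → coeff R z m) (LP.++-assoc p q r))) ⟫ }
        ; identity = (λ p → ⟪ (λ m → refl) ⟫)
                   , (λ p → ⟪ (λ m → reflexive (≡.cong (λ z → coeff R z m) (LP.++-identityʳ p))) ⟫) }
      ; comm = λ p q → ⟪ (λ m → trans (coeff-++ p q m) (trans (+-comm _ _) (sym (coeff-++ q p m)))) ⟫ } }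

  module P = ListSums +P-commutativeMonoid
  open CommutativeMonoid +P-commutativeMonoid public
    using () renaming (refl to ≈P-refl; sym to ≈P-sym; trans to ≈P-trans; reflexive to ≈P-reflexive;
                       ∙-cong to ++-cong; assoc to ++-assoc; comm to ++-comm; identityʳ to ++-identityʳ)

  sumₚ-sumL : ∀ {x} {X : Set x} (L : List X) (f : X → Pl) → sumₚ R (map f L) ≡ P.sumL L f
  sumₚ-sumL [] f = ≡.refl
  sumₚ-sumL (l ∷ L) f = ≡.cong (f l ++_) (sumₚ-sumL L f)

  coeff-sumL : ∀ {x} {X : Set x} (L : List X) (f : X → Pl) m → coeff R (P.sumL L f) m ≈ C.sumL L (λ l → coeff R (f l) m)
  coeff-sumL [] f m = refl
  coeff-sumL (l ∷ L) f m = trans (coeff-++ (f l) _ m) (+-cong refl (coeff-sumL L f m))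

  sumL-neg : ∀ {x} {X : Set x} (L : List X) (f : X → Carrier) → C.sumL L (λ l → - f l) ≈ - C.sumL L f
  sumL-neg [] f = sym -0#≈0#
  sumL-neg (l ∷ L) f = trans (+-cong refl (sumL-neg L f)) (-‿+-comm _ _)

  sumL-*ˡ : ∀ {x} {X : Set x} (L : List X) a (f : X → Carrier) → C.sumL L (λ l → a * f l) ≈ a * C.sumL L f
  sumL-*ˡ [] a f = sym (zeroʳ a)
  sumL-*ˡ (l ∷ L) a f = trans (+-cong refl (sumL-*ˡ L a f)) (sym (distribˡ _ _ _))

  coeff-neg : ∀ (p : Pl) m → coeff R (-ₚ_ R p) m ≈ - coeff R p m
  coeff-neg p m = begin
    coeff R (-ₚ_ R p) m                          ≈⟨ coeff-sum (-ₚ_ R p) m ⟩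
    C.sumL (-ₚ_ R p) (λ t → termCoeff t m)        ≡⟨ C.sumL-map _ p _ ⟩
    C.sumL p (λ t → termCoeff (- proj₁ t , proj₂ t) m) ≈⟨ C.sumL-cong p (λ t → termCoeff-neg (proj₁ t) (proj₂ t) m) ⟩
    C.sumL p (λ t → - termCoeff t m)              ≈⟨ sumL-neg p _ ⟩
    - C.sumL p (λ t → termCoeff t m)              ≈⟨ -‿cong (sym (coeff-sum p m)) ⟩
    - coeff R p m                                ∎

  mapMon : (Mon n → Mon n) → Term → Term
  mapMon g t = (proj₁ t , g (proj₂ t))

  imageCoeff : (Mon n → Mon n) → Pl → Mon n → Carrier
  imageCoeff g p m = C.sumL p (λ t → termCoeff (mapMon g t) m)

  coeff-map : ∀ g (p : Pl) m → coeff R (map (mapMon g) p) m ≈ imageCoeff g p m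
  coeff-map g p m = trans (coeff-sum (map (mapMon g) p) m) (reflexive (C.sumL-map (mapMon g) p (λ t → termCoeff t m)))

  imageCoeff-neg : ∀ g (q : Pl) m → imageCoeff g (-ₚ_ R q) m ≈ - imageCoeff g q m
  imageCoeff-neg g q m = begin
    imageCoeff g (-ₚ_ R q) m                              ≡⟨ C.sumL-map _ q _ ⟩
    C.sumL q (λ t → termCoeff (- proj₁ t , g (proj₂ t)) m) ≈⟨ C.sumL-cong q (λ t → termCoeff-neg (proj₁ t) (g (proj₂ t)) m) ⟩
    C.sumL q (λ t → - termCoeff (mapMon g t) m)            ≈⟨ sumL-neg q _ ⟩
    - imageCoeff g q m                                     ∎

  Vanishes : Pl → Set ℓ
  Vanishes D = ∀ f → imageCoeff id D f ≈ 0#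

  module HeadClass (b₀ : Carrier) (f₀ : Mon n) (D : Pl) (D₀-vanishes : Vanishes ((b₀ , f₀) ∷ D)) where
    sameMon? : (t : Term) → Dec (proj₂ t ≡ f₀)
    sameMon? t = proj₂ t ≟ᴹ f₀

    Same Other : Pl
    Same = filter sameMon? D
    Other = filter (λ t → ¬? (sameMon? t)) D

    split : ∀ (h : Term → Carrier) → C.sumL D h ≈ C.sumL Same h + C.sumL Other h
    split h = C.sumL-partition sameMon? D h

    imageCoeff-Same : ∀ g f → imageCoeff g Same f ≈ (if does (g f₀ ≟ᴹ f) then C.sumL Same proj₁ else 0#)
    imageCoeff-Same g f =
      trans (C.sumL-cong∈ Same (λ t t∈ → reflexive (≡.cong (λ e → termCoeff (proj₁ t , g e) f) (proj₂ (∈-filter⁻ sameMon? {xs = D} t∈)))))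
            (C.sumL-if Same (does (g f₀ ≟ᴹ f)) proj₁)

    Other-at-f₀ : imageCoeff id Other f₀ ≈ 0#
    Other-at-f₀ = trans (C.sumL-cong∈ Other (λ t t∈ → reflexive (termCoeff-≢ (proj₁ t)
                          (proj₂ (∈-filter⁻ (λ t → ¬? (sameMon? t)) {xs = D} t∈))))) (C.sumL-zero Other)

    -- The coefficient of f₀ in the whole list is b₀ + Σ Same.
    class-sum : b₀ + C.sumL Same proj₁ ≈ 0#
    class-sum = begin
      b₀ + C.sumL Same proj₁
        ≈⟨ +-cong (reflexive (≡.sym (termCoeff-≡ b₀ f₀)))
                  (trans (reflexive (≡.sym (≡.cong (λ b → if b then C.sumL Same proj₁ else 0#) (dec-true (f₀ ≟ᴹ f₀) ≡.refl))))
                         (sym (trans (+-cong (imageCoeff-Same id f₀) Other-at-f₀) (+-identityʳ _)))) ⟩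
      termCoeff (b₀ , f₀) f₀ + (imageCoeff id Same f₀ + imageCoeff id Other f₀)
        ≈⟨ +-cong refl (sym (split _)) ⟩
      termCoeff (b₀ , f₀) f₀ + imageCoeff id D f₀
        ≈⟨ D₀-vanishes f₀ ⟩
      0# ∎

    Other-vanishes : Vanishes Other
    Other-vanishes f with f₀ ≟ᴹ f
    ... | yes ≡.refl = Other-at-f₀
    ... | no f₀≢f = begin
      imageCoeff id Other f
        ≈⟨ sym (+-identityˡ _) ⟩
      0# + imageCoeff id Other f
        ≈⟨ +-cong (trans (reflexive (≡.sym (≡.cong (λ b → if b then C.sumL Same proj₁ else 0#) (dec-false (f₀ ≟ᴹ f) f₀≢f))))
                         (sym (imageCoeff-Same id f))) refl ⟩
      imageCoeff id Same f + imageCoeff id Other f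
        ≈⟨ sym (split _) ⟩
      imageCoeff id D f
        ≈⟨ sym (trans (+-cong (reflexive (termCoeff-≢ b₀ f₀≢f)) refl) (+-identityˡ _)) ⟩
      termCoeff (b₀ , f₀) f + imageCoeff id D f
        ≈⟨ D₀-vanishes f ⟩
      0# ∎

  -- The image of a vanishing polynomial vanishes, by induction on the number
  -- of terms: the class of the head is mapped to a single monomial and sums
  -- to zero, and the remaining terms vanish.
  image-vanishes : ∀ N (D : Pl) → length D ℕ.≤ N → Vanishes D → ∀ g m → imageCoeff g D m ≈ 0#
  image-vanishes N [] _ _ g m = refl
  image-vanishes (suc N) ((b₀ , f₀) ∷ D) (ℕ.s≤s len≤N) D₀-vanishes g m = begin
      termCoeff (b₀ , g f₀) m + imageCoeff g D m
        ≈⟨ +-cong refl (split _) ⟩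
      termCoeff (b₀ , g f₀) m + (imageCoeff g Same m + imageCoeff g Other m)
        ≈⟨ +-cong refl (+-cong (imageCoeff-Same g m) (image-vanishes N Other Other-length Other-vanishes g m)) ⟩
      (if does (g f₀ ≟ᴹ m) then b₀ else 0#) + ((if does (g f₀ ≟ᴹ m) then C.sumL Same proj₁ else 0#) + 0#)
        ≈⟨ +-cong refl (+-identityʳ _) ⟩
      (if does (g f₀ ≟ᴹ m) then b₀ else 0#) + (if does (g f₀ ≟ᴹ m) then C.sumL Same proj₁ else 0#)
        ≈⟨ guarded-zero (does (g f₀ ≟ᴹ m)) ⟩
      0# ∎
    where
    open HeadClass b₀ f₀ D D₀-vanishes
    Other-length : length Other ℕ.≤ N
    Other-length = ℕP.≤-trans (LP.length-filter (λ t → ¬? (sameMon? t)) D) len≤N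
    guarded-zero : ∀ b → (if b then b₀ else 0#) + (if b then C.sumL Same proj₁ else 0#) ≈ 0#
    guarded-zero true = class-sum
    guarded-zero false = +-identityˡ 0#

  -- Hence images respect coefficientwise equality: apply the above to p − q.
  imageCoeff-cong : ∀ g {p q : Pl} → p ≈P q → ∀ m → imageCoeff g p m ≈ imageCoeff g q m
  imageCoeff-cong g {p} {q} p≈q m =
    difference-zero (trans (sym (split g m)) (image-vanishes (length D) D ℕP.≤-refl D-vanishes g m))
    where
    D : Pl
    D = p ++ -ₚ_ R q
    split : ∀ h f → imageCoeff h D f ≈ imageCoeff h p f + - imageCoeff h q f
    split h f = trans (C.sumL-++ p (-ₚ_ R q) _) (+-cong refl (imageCoeff-neg h q f))
    D-vanishes : Vanishes D
    D-vanishes f = begin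
      imageCoeff id D f                             ≈⟨ split id f ⟩
      imageCoeff id p f + - imageCoeff id q f       ≈⟨ +-cong (sym (coeff-sum p f)) (-‿cong (sym (coeff-sum q f))) ⟩
      coeff R p f + - coeff R q f                   ≈⟨ +-cong (coeffs p≈q f) refl ⟩
      coeff R q f + - coeff R q f                   ≈⟨ -‿inverseʳ _ ⟩
      0# ∎
    difference-zero : ∀ {x y} → x + - y ≈ 0# → x ≈ y
    difference-zero {x} {y} x-y≈0 = begin
      x             ≈⟨ sym (+-identityʳ x) ⟩
      x + 0#        ≈⟨ +-cong refl (sym (-‿inverseˡ y)) ⟩
      x + (- y + y) ≈⟨ sym (+-assoc _ _ _) ⟩
      (x + - y) + y ≈⟨ +-cong x-y≈0 refl ⟩
      0# + y        ≈⟨ +-identityˡ y ⟩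
      y             ∎

  map-cong : ∀ g {p q : Pl} → p ≈P q → map (mapMon g) p ≈P map (mapMon g) q
  map-cong g {p} {q} p≈q = ⟪ (λ m → trans (coeff-map g p m) (trans (imageCoeff-cong g p≈q m) (sym (coeff-map g q m)))) ⟫

  _⊗_ : Term → Term → Term
  s ⊗ t = (proj₁ s * proj₁ t , proj₂ s ·ᴹ proj₂ t)

  infixl 7 _⊛_
  _⊛_ : Pl → Pl → Pl
  p ⊛ q = _*ₚ_ R p q

  sumL-⊛ : ∀ (p q : Pl) (F : Term → Carrier) → C.sumL (p ⊛ q) F ≈ C.sumL p (λ s → C.sumL q (λ t → F (s ⊗ t)))
  sumL-⊛ p q F = trans (C.sumL-concatMap _ p F) (C.sumL-cong p (λ s → reflexive (C.sumL-map (s ⊗_) q F)))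

  coeff-⊛ : ∀ (p q : Pl) m → coeff R (p ⊛ q) m ≈ C.sumL p (λ s → C.sumL q (λ t → termCoeff (s ⊗ t) m))
  coeff-⊛ p q m = trans (coeff-sum (p ⊛ q) m) (sumL-⊛ p q (λ t → termCoeff t m))

  term-⊛ : ∀ s (q : Pl) m → C.sumL q (λ t → termCoeff (s ⊗ t) m) ≈ proj₁ s * imageCoeff (proj₂ s ·ᴹ_) q m
  term-⊛ s q m = trans (C.sumL-cong q (λ t → termCoeff-*ˡ (proj₁ s) (proj₁ t) (proj₂ s ·ᴹ proj₂ t) m)) (sumL-*ˡ q (proj₁ s) _)

  -- The commutative-semiring laws of ⊛ up to ≈P.  Compatibility with ≈P
  -- needs image-vanishes, since the monomials of q are translated.
  ⊛-congʳ : ∀ (p : Pl) {q q′} → q ≈P q′ → p ⊛ q ≈P p ⊛ q′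
  ⊛-congʳ p {q} {q′} q≈q′ = ⟪ (λ m → begin
    coeff R (p ⊛ q) m                                         ≈⟨ coeff-⊛ p q m ⟩
    C.sumL p (λ s → C.sumL q (λ t → termCoeff (s ⊗ t) m))     ≈⟨ C.sumL-cong p (λ s → trans (term-⊛ s q m)
                                                                   (trans (*-cong refl (imageCoeff-cong (proj₂ s ·ᴹ_) q≈q′ m)) (sym (term-⊛ s q′ m)))) ⟩
    C.sumL p (λ s → C.sumL q′ (λ t → termCoeff (s ⊗ t) m))    ≈⟨ sym (coeff-⊛ p q′ m) ⟩
    coeff R (p ⊛ q′) m                                        ∎) ⟫

  ⊛-comm : ∀ (p q : Pl) → p ⊛ q ≈P q ⊛ p
  ⊛-comm p q = ⟪ (λ m → begin
    coeff R (p ⊛ q) m                                       ≈⟨ coeff-⊛ p q m ⟩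
    C.sumL p (λ s → C.sumL q (λ t → termCoeff (s ⊗ t) m))   ≈⟨ C.sumL-swap p q _ ⟩
    C.sumL q (λ t → C.sumL p (λ s → termCoeff (s ⊗ t) m))   ≈⟨ C.sumL-cong q (λ t → C.sumL-cong p (λ s → ⊗-comm s t m)) ⟩
    C.sumL q (λ t → C.sumL p (λ s → termCoeff (t ⊗ s) m))   ≈⟨ sym (coeff-⊛ q p m) ⟩
    coeff R (q ⊛ p) m                                       ∎) ⟫
    where
    ⊗-comm : ∀ s t m → termCoeff (s ⊗ t) m ≈ termCoeff (t ⊗ s) m
    ⊗-comm s t m = trans (termCoeff-cong (proj₂ s ·ᴹ proj₂ t) m (*-comm (proj₁ s) (proj₁ t)))
                         (reflexive (termCoeff-mon _ m (·ᴹ-comm (proj₂ s) (proj₂ t))))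

  ⊛-congˡ : ∀ {p p′} (q : Pl) → p ≈P p′ → p ⊛ q ≈P p′ ⊛ q
  ⊛-congˡ {p} {p′} q p≈p′ = ≈P-trans (⊛-comm p q) (≈P-trans (⊛-congʳ q p≈p′) (⊛-comm q p′))

  ⊛-assoc : ∀ (p q r : Pl) → (p ⊛ q) ⊛ r ≈P p ⊛ (q ⊛ r)
  ⊛-assoc p q r = ⟪ (λ m → begin
    coeff R ((p ⊛ q) ⊛ r) m
      ≈⟨ coeff-⊛ (p ⊛ q) r m ⟩
    C.sumL (p ⊛ q) (λ u → C.sumL r (λ w → termCoeff (u ⊗ w) m))
      ≈⟨ sumL-⊛ p q _ ⟩
    C.sumL p (λ s → C.sumL q (λ t → C.sumL r (λ w → termCoeff ((s ⊗ t) ⊗ w) m)))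
      ≈⟨ C.sumL-cong p (λ s → C.sumL-cong q (λ t → C.sumL-cong r (λ w → ⊗-assoc s t w m))) ⟩
    C.sumL p (λ s → C.sumL q (λ t → C.sumL r (λ w → termCoeff (s ⊗ (t ⊗ w)) m)))
      ≈⟨ C.sumL-cong p (λ s → sym (sumL-⊛ q r (λ u → termCoeff (s ⊗ u) m))) ⟩
    C.sumL p (λ s → C.sumL (q ⊛ r) (λ u → termCoeff (s ⊗ u) m))
      ≈⟨ sym (coeff-⊛ p (q ⊛ r) m) ⟩
    coeff R (p ⊛ (q ⊛ r)) m ∎) ⟫
    where
    ⊗-assoc : ∀ s t u m → termCoeff ((s ⊗ t) ⊗ u) m ≈ termCoeff (s ⊗ (t ⊗ u)) m
    ⊗-assoc s t u m = trans (termCoeff-cong ((proj₂ s ·ᴹ proj₂ t) ·ᴹ proj₂ u) m (*-assoc (proj₁ s) (proj₁ t) (proj₁ u)))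
                            (reflexive (termCoeff-mon _ m (·ᴹ-assoc (proj₂ s) (proj₂ t) (proj₂ u))))

  ⊛-distribˡ : ∀ (p q r : Pl) → p ⊛ (q ++ r) ≈P (p ⊛ q) ++ (p ⊛ r)
  ⊛-distribˡ p q r = ⟪ (λ m → begin
    coeff R (p ⊛ (q ++ r)) m
      ≈⟨ coeff-⊛ p (q ++ r) m ⟩
    C.sumL p (λ s → C.sumL (q ++ r) (λ t → termCoeff (s ⊗ t) m))
      ≈⟨ C.sumL-cong p (λ s → C.sumL-++ q r _) ⟩
    C.sumL p (λ s → C.sumL q (λ t → termCoeff (s ⊗ t) m) + C.sumL r (λ t → termCoeff (s ⊗ t) m))
      ≈⟨ C.sumL-∙ p _ _ ⟩
    C.sumL p (λ s → C.sumL q (λ t → termCoeff (s ⊗ t) m)) + C.sumL p (λ s → C.sumL r (λ t → termCoeff (s ⊗ t) m))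
      ≈⟨ sym (+-cong (coeff-⊛ p q m) (coeff-⊛ p r m)) ⟩
    coeff R (p ⊛ q) m + coeff R (p ⊛ r) m
      ≈⟨ sym (coeff-++ (p ⊛ q) (p ⊛ r) m) ⟩
    coeff R ((p ⊛ q) ++ (p ⊛ r)) m ∎) ⟫

  ⊛-distribʳ : ∀ (p q r : Pl) → (p ++ q) ⊛ r ≈P (p ⊛ r) ++ (q ⊛ r)
  ⊛-distribʳ p q r = ≈P-reflexive (LP.concatMap-++ (λ s → map (s ⊗_) r) p q)

  ⊛-zeroʳ : ∀ (p : Pl) → p ⊛ [] ≈P []
  ⊛-zeroʳ p = ⟪ (λ m → trans (coeff-⊛ p [] m) (C.sumL-zero p)) ⟫

  ⊛-identityˡ : ∀ (p : Pl) → constₚ R 1# ⊛ p ≈P p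
  ⊛-identityˡ p = ⟪ (λ m → begin
    coeff R (constₚ R 1# ⊛ p) m
      ≈⟨ trans (coeff-⊛ (constₚ R 1#) p m) (+-identityʳ _) ⟩
    C.sumL p (λ t → termCoeff ((1# , zeroMon) ⊗ t) m)
      ≈⟨ C.sumL-cong p (λ t → trans (termCoeff-cong (zeroMon ·ᴹ proj₂ t) m (*-identityˡ _))
                                    (reflexive (termCoeff-mon _ m (·ᴹ-identityˡ (proj₂ t))))) ⟩
    C.sumL p (λ t → termCoeff t m)
      ≈⟨ sym (coeff-sum p m) ⟩
    coeff R p m ∎) ⟫

  ⊛-negˡ : ∀ (p q : Pl) → (-ₚ_ R p) ⊛ q ≈P -ₚ_ R (p ⊛ q)
  ⊛-negˡ p q = ⟪ (λ m → begin
    coeff R ((-ₚ_ R p) ⊛ q) m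
      ≈⟨ coeff-⊛ (-ₚ_ R p) q m ⟩
    C.sumL (-ₚ_ R p) (λ s → C.sumL q (λ t → termCoeff (s ⊗ t) m))
      ≡⟨ C.sumL-map _ p _ ⟩
    C.sumL p (λ s → C.sumL q (λ t → termCoeff ((- proj₁ s , proj₂ s) ⊗ t) m))
      ≈⟨ C.sumL-cong p (λ s → C.sumL-cong q (λ t → neg-⊗ s t)) ⟩
    C.sumL p (λ s → C.sumL q (λ t → - termCoeff (s ⊗ t) m))
      ≈⟨ trans (C.sumL-cong p (λ s → sumL-neg q _)) (sumL-neg p _) ⟩
    - C.sumL p (λ s → C.sumL q (λ t → termCoeff (s ⊗ t) m))
      ≈⟨ -‿cong (sym (coeff-⊛ p q m)) ⟩
    - coeff R (p ⊛ q) m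
      ≈⟨ sym (coeff-neg (p ⊛ q) m) ⟩
    coeff R (-ₚ_ R (p ⊛ q)) m ∎) ⟫
    where
    neg-⊗ : ∀ s t {m} → termCoeff ((- proj₁ s , proj₂ s) ⊗ t) m ≈ - termCoeff (s ⊗ t) m
    neg-⊗ s t {m} = trans (termCoeff-cong (proj₂ s ·ᴹ proj₂ t) m (sym (-‿distribˡ-* (proj₁ s) (proj₁ t))))
                          (termCoeff-neg (proj₁ s * proj₁ t) (proj₂ s ·ᴹ proj₂ t) m)

  ⊛-negʳ : ∀ (p q : Pl) → p ⊛ (-ₚ_ R q) ≈P -ₚ_ R (p ⊛ q)
  ⊛-negʳ p q = ≈P-trans (⊛-comm p (-ₚ_ R q)) (≈P-trans (⊛-negˡ q p)
    ⟪ (λ m → trans (coeff-neg (q ⊛ p) m) (trans (-‿cong (coeffs (⊛-comm q p) m)) (sym (coeff-neg (p ⊛ q) m)))) ⟫)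

  ⊛-sumʳ : ∀ {x} {X : Set x} (p : Pl) (L : List X) (f : X → Pl) → p ⊛ P.sumL L f ≈P P.sumL L (λ l → p ⊛ f l)
  ⊛-sumʳ p [] f = ⊛-zeroʳ p
  ⊛-sumʳ p (l ∷ L) f = ≈P-trans (⊛-distribˡ p (f l) (P.sumL L f)) (++-cong ≈P-refl (⊛-sumʳ p L f))

  ⊛-swapˡ : ∀ (p q r : Pl) → p ⊛ (q ⊛ r) ≈P q ⊛ (p ⊛ r)
  ⊛-swapˡ p q r = ≈P-trans (≈P-sym (⊛-assoc p q r)) (≈P-trans (⊛-congˡ r (⊛-comm p q)) (⊛-assoc q p r))

  ⊛-rotate : ∀ (p q r : Pl) → p ⊛ (q ⊛ r) ≈P r ⊛ (p ⊛ q)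
  ⊛-rotate p q r = ≈P-trans (≈P-sym (⊛-assoc p q r)) (⊛-comm (p ⊛ q) r)

  single-cong : ∀ {a b : Carrier} {e f : Mon n} → a ≈ b → e ≡ f → ((a , e) ∷ []) ≈P ((b , f) ∷ [])
  single-cong {a} {b} {e} a≈b ≡.refl = ⟪ (λ m →
    trans (coeff-sum ((a , e) ∷ []) m) (trans (+-cong (termCoeff-cong e m a≈b) refl) (sym (coeff-sum ((b , e) ∷ []) m)))) ⟫

  single-⊛ : ∀ (s t : Term) → (s ∷ []) ⊛ (t ∷ []) ≈P ((s ⊗ t) ∷ [])
  single-⊛ s t = ++-identityʳ ((s ⊗ t) ∷ [])

  const-0 : [] ≈P constₚ R 0#
  const-0 = ⟪ (λ m → sym (trans (coeff-sum (constₚ R 0#) m) (trans (+-identityʳ _) (if-0 (does (zeroMon ≟ᴹ m)))))) ⟫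
    where
    if-0 : ∀ b → (if b then 0# else 0#) ≈ 0#
    if-0 true = refl
    if-0 false = refl

  const-+ : ∀ a b → (constₚ R a ++ constₚ R b) ≈P constₚ R (a + b)
  const-+ a b = ⟪ (λ m → trans (coeff-++ (constₚ R a) (constₚ R b) m)
    (trans (+-cong (coeff-sum (constₚ R a) m) (coeff-sum (constₚ R b) m))
    (trans (if-+ (does (zeroMon ≟ᴹ m))) (sym (coeff-sum (constₚ R (a + b)) m))))) ⟫
    where
    if-+ : ∀ b′ → ((if b′ then a else 0#) + 0#) + ((if b′ then b else 0#) + 0#) ≈ (if b′ then a + b else 0#) + 0#
    if-+ true = trans (+-cong (+-identityʳ a) (+-identityʳ b)) (sym (+-identityʳ _))
    if-+ false = +-cong (+-identityʳ 0#) (+-identityʳ 0#)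

  const-sumL : ∀ {x} {X : Set x} (L : List X) (f : X → Carrier) → P.sumL L (λ l → constₚ R (f l)) ≈P constₚ R (C.sumL L f)
  const-sumL [] f = const-0
  const-sumL (l ∷ L) f = ≈P-trans (++-cong ≈P-refl (const-sumL L f)) (const-+ (f l) (C.sumL L f))

  const-× : ∀ k a → k P.× constₚ R a ≈P constₚ R (k C.× a)
  const-× zero a = const-0
  const-× (suc k) a = ≈P-trans (++-cong ≈P-refl (const-× k a)) (const-+ a (k C.× a))

  sub-add : ∀ (p q : Pl) → ((p ++ (-ₚ_ R q)) ++ q) ≈P p
  sub-add p q = ⟪ (λ m → begin
    coeff R ((p ++ (-ₚ_ R q)) ++ q) m      ≈⟨ trans (coeff-++ (p ++ (-ₚ_ R q)) q m) (+-cong (coeff-++ p _ m) refl) ⟩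
    (coeff R p m + coeff R (-ₚ_ R q) m) + coeff R q m ≈⟨ +-cong (+-cong refl (coeff-neg q m)) refl ⟩
    (coeff R p m + - coeff R q m) + coeff R q m       ≈⟨ +-assoc _ _ _ ⟩
    coeff R p m + (- coeff R q m + coeff R q m)       ≈⟨ +-cong refl (-‿inverseˡ _) ⟩
    coeff R p m + 0#                                  ≈⟨ +-identityʳ _ ⟩
    coeff R p m ∎) ⟫

  -- The degree of a polynomial: DegLE from the statement is the semantic
  -- bound (vanishing coefficients above d); AllDeg≤ p d is the syntactic
  -- bound (every term of the list has degree ≤ d), which implies it.
  AllDeg≤ : Pl → ℕ → Set c
  AllDeg≤ p d = All (λ t → totalDeg (proj₂ t) ℕ.≤ d) p

  AllDeg≤⇒DegLE : ∀ {p d} → AllDeg≤ p d → DegLE R p d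
  AllDeg≤⇒DegLE {p} {d} p≤d m d<m = trans (coeff-sum p m) (trans (C.sumL-cong∈ p (λ t t∈ →
      reflexive (termCoeff-≢ (proj₁ t) {proj₂ t} {m} (λ e≡m →
        ℕP.<-irrefl ≡.refl (ℕP.<-≤-trans d<m (≡.subst (λ z → totalDeg z ℕ.≤ d) e≡m (All.lookup p≤d t∈)))))))
    (C.sumL-zero p))

  DegLE-≈ : ∀ {p q d} → p ≈P q → DegLE R p d → DegLE R q d
  DegLE-≈ p≈q p≤d m d<m = trans (sym (coeffs p≈q m)) (p≤d m d<m)

  DegLE-++ : ∀ {p q d} → DegLE R p d → DegLE R q d → DegLE R (p ++ q) d
  DegLE-++ {p} {q} p≤d q≤d m d<m = trans (coeff-++ p q m) (trans (+-cong (p≤d m d<m) (q≤d m d<m)) (+-identityˡ 0#))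

  DegLE-neg : ∀ {p d} → DegLE R p d → DegLE R (-ₚ_ R p) d
  DegLE-neg {p} p≤d m d<m = trans (coeff-neg p m) (trans (-‿cong (p≤d m d<m)) -0#≈0#)

  DegLE-mono : ∀ {p : Pl} {d d′} → d ℕ.≤ d′ → DegLE R p d → DegLE R p d′
  DegLE-mono d≤d′ p≤d m d′<m = p≤d m (ℕP.≤-<-trans d≤d′ d′<m)

  DegLE-[] : ∀ {d} → DegLE R {n} [] d
  DegLE-[] m _ = refl

  -- Translating by e only hits monomials divisible by e.
  imageCoeff-· : ∀ e (X : Pl) m → imageCoeff (e ·ᴹ_) X m ≈ (if does ((e ·ᴹ (m ∸ᴹ e)) ≟ᴹ m) then coeff R X (m ∸ᴹ e) else 0#)
  imageCoeff-· e X m with (e ·ᴹ (m ∸ᴹ e)) ≟ᴹ m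
  ... | yes e·[m/e]≡m = trans (C.sumL-cong X (λ t → reflexive (≡.cong (λ b → if b then proj₁ t else 0#)
          (does-⇔ (mk⇔ ·ᴹ-cancel (λ t≡m/e → ≡.trans (≡.cong (e ·ᴹ_) t≡m/e) e·[m/e]≡m)) ((e ·ᴹ proj₂ t) ≟ᴹ m) (proj₂ t ≟ᴹ (m ∸ᴹ e))))))
          (sym (coeff-sum X (m ∸ᴹ e)))
  ... | no e∤m = trans (C.sumL-cong X (λ t → reflexive (termCoeff-≢ (proj₁ t)
          (λ e·t≡m → e∤m (≡.subst (λ z → e ·ᴹ z ≡ m) (·ᴹ-cancel e·t≡m) e·t≡m))))) (C.sumL-zero X)

  DegLE-⊛ : ∀ {H X h d} → AllDeg≤ H h → DegLE R X d → DegLE R (H ⊛ X) (h ℕ.+ d)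
  DegLE-⊛ {H} {X} {h} {d} H≤h X≤d m h+d<m = trans (coeff-⊛ H X m) (trans (C.sumL-cong∈ H (λ s s∈ →
      trans (term-⊛ s X m) (trans (*-cong refl (imageCoeff-· (proj₂ s) X m))
            (trans (*-cong refl (quotient-vanishes s (All.lookup H≤h s∈))) (zeroʳ _)))))
    (C.sumL-zero H))
    where
    quotient-vanishes : ∀ s → totalDeg (proj₂ s) ℕ.≤ h →
      (if does ((proj₂ s ·ᴹ (m ∸ᴹ proj₂ s)) ≟ᴹ m) then coeff R X (m ∸ᴹ proj₂ s) else 0#) ≈ 0#
    quotient-vanishes s s≤h with (proj₂ s ·ᴹ (m ∸ᴹ proj₂ s)) ≟ᴹ m
    ... | no _ = refl
    ... | yes e·q≡m = X≤d (m ∸ᴹ proj₂ s) (ℕP.+-cancelˡ-< (totalDeg (proj₂ s)) d _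
            (ℕP.<-≤-trans (ℕP.≤-<-trans (ℕP.+-monoˡ-≤ d s≤h) h+d<m)
              (ℕP.≤-reflexive (≡.trans (≡.cong totalDeg (≡.sym e·q≡m)) (totalDeg-· (proj₂ s) (m ∸ᴹ proj₂ s))))))

  AllDeg≤-++ : ∀ {p q d} → AllDeg≤ p d → AllDeg≤ q d → AllDeg≤ (p ++ q) d
  AllDeg≤-++ = AllP.++⁺

  AllDeg≤-mono : ∀ {p d d′} → d ℕ.≤ d′ → AllDeg≤ p d → AllDeg≤ p d′
  AllDeg≤-mono d≤d′ = All.map (λ t≤d → ℕP.≤-trans t≤d d≤d′)

  AllDeg≤-⊛ : ∀ {p q a b} → AllDeg≤ p a → AllDeg≤ q b → AllDeg≤ (p ⊛ q) (a ℕ.+ b)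
  AllDeg≤-⊛ p≤a q≤b = AllP.concat⁺ (AllP.map⁺ (All.map (λ {s} s≤a → AllP.map⁺ (All.map
      (λ {t} t≤b → ℕP.≤-trans (ℕP.≤-reflexive (totalDeg-· (proj₂ s) (proj₂ t))) (ℕP.+-mono-≤ s≤a t≤b)) q≤b)) p≤a))

  AllDeg≤-const : ∀ a d → AllDeg≤ (constₚ R a) d
  AllDeg≤-const a d = ℕP.≤-trans (ℕP.≤-reflexive totalDeg-0) ℕ.z≤n All.∷ All.[]

  AllDeg≤-x : ∀ i j → AllDeg≤ (x R i j) 1
  AllDeg≤-x i j = ℕP.≤-reflexive (totalDeg-var i j) All.∷ All.[]

  AllDeg≤-neg : ∀ {p d} → AllDeg≤ p d → AllDeg≤ (-ₚ_ R p) d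
  AllDeg≤-neg p≤d = AllP.map⁺ p≤d

  AllDeg≤-sumL : ∀ {x} {X : Set x} (L : List X) (f : X → Pl) d → (∀ l → AllDeg≤ (f l) d) → AllDeg≤ (P.sumL L f) d
  AllDeg≤-sumL [] f d h = All.[]
  AllDeg≤-sumL (l ∷ L) f d h = AllDeg≤-++ (h l) (AllDeg≤-sumL L f d h)

-- Degree-d derivations F ≡ G from a list of axioms 𝒫 (the relation
-- F ≡_{(𝒫,d)} G of the paper, with the multipliers packaged in a record).
module Derivations {c ℓ} (R : CommutativeRing c ℓ) (n : ℕ) (𝒫 : List (Poly R n)) where
  open CommutativeRing R
  open Polynomials R n

  axiom : Fin (length 𝒫) → Pl
  axiom = List.lookup 𝒫

  combination : (Fin (length 𝒫) → Pl) → Pl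
  combination q = P.sumL (allFin (length 𝒫)) (λ k → q k ⊛ axiom k)

  infix 4 _≡[_]_
  record _≡[_]_ (F : Pl) (d : ℕ) (G : Pl) : Set (c ⊔ ℓ) where
    constructor derivation
    field
      multipliers : Fin (length 𝒫) → Pl
      identity : (F ++ combination multipliers) ≈P G
      degree-bound : ∀ k → DegLE R (multipliers k ⊛ axiom k) d

  toEquivMod : ∀ {d F G} → F ≡[ d ] G → EquivMod R 𝒫 d F G
  toEquivMod {d} {F} (derivation q F+Σ≈G deg) =
    q , (λ m → trans (reflexive (≡.cong (λ z → coeff R (F ++ z) m) (sumₚ-sumL (allFin (length 𝒫)) (λ k → q k ⊛ axiom k)))) (coeffs F+Σ≈G m))
      , deg

  private
    _⊕_ : (Fin (length 𝒫) → Pl) → (Fin (length 𝒫) → Pl) → Fin (length 𝒫) → Pl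
    (q₁ ⊕ q₂) k = q₁ k ++ q₂ k

    combination-⊕ : ∀ q₁ q₂ → combination (q₁ ⊕ q₂) ≈P (combination q₁ ++ combination q₂)
    combination-⊕ q₁ q₂ = ≈P-trans (P.sumL-cong (allFin (length 𝒫)) (λ k → ⊛-distribʳ (q₁ k) (q₂ k) (axiom k)))
                                   (P.sumL-∙ (allFin (length 𝒫)) _ _)

    degree-⊕ : ∀ {d} q₁ q₂ → (∀ k → DegLE R (q₁ k ⊛ axiom k) d) → (∀ k → DegLE R (q₂ k ⊛ axiom k) d) →
      ∀ k → DegLE R ((q₁ ⊕ q₂) k ⊛ axiom k) d
    degree-⊕ q₁ q₂ deg₁ deg₂ k =
      DegLE-≈ (≈P-sym (⊛-distribʳ (q₁ k) (q₂ k) (axiom k))) (DegLE-++ {q₁ k ⊛ axiom k} {q₂ k ⊛ axiom k} (deg₁ k) (deg₂ k))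

  ≡-refl : ∀ {d} F → F ≡[ d ] F
  ≡-refl F = derivation (λ _ → []) (≈P-trans (++-cong ≈P-refl (P.sumL-zero (allFin (length 𝒫)))) (++-identityʳ F)) (λ k → DegLE-[])

  ≡-respects : ∀ {d F F′ G G′} → F′ ≈P F → F ≡[ d ] G → G ≈P G′ → F′ ≡[ d ] G′
  ≡-respects F′≈F (derivation q F+Σ≈G deg) G≈G′ = derivation q (≈P-trans (++-cong F′≈F ≈P-refl) (≈P-trans F+Σ≈G G≈G′)) deg

  ≡-mono : ∀ {d d′ F G} → d ℕ.≤ d′ → F ≡[ d ] G → F ≡[ d′ ] G
  ≡-mono d≤d′ (derivation q F+Σ≈G deg) = derivation q F+Σ≈G (λ k → DegLE-mono {q k ⊛ axiom k} d≤d′ (deg k))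

  ≡-trans : ∀ {d F G H} → F ≡[ d ] G → G ≡[ d ] H → F ≡[ d ] H
  ≡-trans {F = F} (derivation q₁ F+Σ₁≈G deg₁) (derivation q₂ G+Σ₂≈H deg₂) = derivation (q₁ ⊕ q₂)
    (≈P-trans (++-cong ≈P-refl (combination-⊕ q₁ q₂))
    (≈P-trans (≈P-sym (++-assoc F (combination q₁) (combination q₂)))
    (≈P-trans (++-cong F+Σ₁≈G ≈P-refl) G+Σ₂≈H)))
    (degree-⊕ q₁ q₂ deg₁ deg₂)

  ≡-+ : ∀ {d F₁ G₁ F₂ G₂} → F₁ ≡[ d ] G₁ → F₂ ≡[ d ] G₂ → (F₁ ++ F₂) ≡[ d ] (G₁ ++ G₂)
  ≡-+ {F₁ = F₁} {F₂ = F₂} (derivation q₁ e₁ deg₁) (derivation q₂ e₂ deg₂) = derivation (q₁ ⊕ q₂)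
    (≈P-trans (++-cong ≈P-refl (combination-⊕ q₁ q₂))
    (≈P-trans (P.interchange F₁ F₂ (combination q₁) (combination q₂)) (++-cong e₁ e₂)))
    (degree-⊕ q₁ q₂ deg₁ deg₂)

  -- Negating the multipliers reverses a derivation.
  ≡-sym : ∀ {d F G} → F ≡[ d ] G → G ≡[ d ] F
  ≡-sym {d} {F} {G} (derivation q F+Σ≈G deg) = derivation (λ k → -ₚ_ R (q k)) ⟪ G-Σ≈F ⟫
    (λ k → DegLE-≈ (≈P-sym (⊛-negˡ (q k) (axiom k))) (DegLE-neg {q k ⊛ axiom k} (deg k)))
    where
    open import Relation.Binary.Reasoning.Setoid setoid
    L : List (Fin (length 𝒫))
    L = allFin (length 𝒫)
    combination-neg : ∀ m → coeff R (combination (λ k → -ₚ_ R (q k))) m ≈ - coeff R (combination q) m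
    combination-neg m = begin
      coeff R (combination (λ k → -ₚ_ R (q k))) m         ≈⟨ coeff-sumL L _ m ⟩
      C.sumL L (λ k → coeff R (-ₚ_ R (q k) ⊛ axiom k) m)   ≈⟨ C.sumL-cong L (λ k → trans (coeffs (⊛-negˡ (q k) (axiom k)) m)
                                                                                         (coeff-neg (q k ⊛ axiom k) m)) ⟩
      C.sumL L (λ k → - coeff R (q k ⊛ axiom k) m)         ≈⟨ sumL-neg L _ ⟩
      - C.sumL L (λ k → coeff R (q k ⊛ axiom k) m)         ≈⟨ -‿cong (sym (coeff-sumL L _ m)) ⟩
      - coeff R (combination q) m                          ∎
    G-Σ≈F : ∀ m → coeff R (G ++ combination (λ k → -ₚ_ R (q k))) m ≈ coeff R F m
    G-Σ≈F m = begin
      coeff R (G ++ combination (λ k → -ₚ_ R (q k))) m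
        ≈⟨ coeff-++ G _ m ⟩
      coeff R G m + coeff R (combination (λ k → -ₚ_ R (q k))) m
        ≈⟨ +-cong (sym (coeffs F+Σ≈G m)) (combination-neg m) ⟩
      coeff R (F ++ combination q) m + - coeff R (combination q) m
        ≈⟨ +-cong (coeff-++ F (combination q) m) refl ⟩
      (coeff R F m + coeff R (combination q) m) + - coeff R (combination q) m
        ≈⟨ +-assoc _ _ _ ⟩
      coeff R F m + (coeff R (combination q) m + - coeff R (combination q) m)
        ≈⟨ +-cong refl (-‿inverseʳ _) ⟩
      coeff R F m + 0#
        ≈⟨ +-identityʳ _ ⟩
      coeff R F m ∎

  ≡-⊛ : ∀ {d h F G} (H : Pl) → AllDeg≤ H h → F ≡[ d ] G → (H ⊛ F) ≡[ h ℕ.+ d ] (H ⊛ G)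
  ≡-⊛ {d} {h} {F} {G} H H≤h (derivation q F+Σ≈G deg) = derivation (λ k → H ⊛ q k) HF+Σ≈HG
    (λ k → DegLE-≈ (≈P-sym (⊛-assoc H (q k) (axiom k))) (DegLE-⊛ H≤h (deg k)))
    where
    HF+Σ≈HG : ((H ⊛ F) ++ combination (λ k → H ⊛ q k)) ≈P (H ⊛ G)
    HF+Σ≈HG = ≈P-trans (++-cong ≈P-refl
                 (≈P-trans (P.sumL-cong (allFin (length 𝒫)) (λ k → ⊛-assoc H (q k) (axiom k)))
                           (≈P-sym (⊛-sumʳ H (allFin (length 𝒫)) (λ k → q k ⊛ axiom k)))))
              (≈P-trans (≈P-sym (⊛-distribˡ H F (combination q))) (⊛-congʳ H F+Σ≈G))

  axiom-multiple : ∀ {d} (p : Pl) → p ∈ 𝒫 → (H : Pl) → DegLE R (H ⊛ p) d → (H ⊛ p) ≡[ d ] []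
  axiom-multiple {d} p p∈𝒫 H Hp≤d = ≡-sym (derivation q Σ≈Hp deg)
    where
    k₀ : Fin (length 𝒫)
    k₀ = Any.index p∈𝒫
    p≡axiom : p ≡ axiom k₀
    p≡axiom = AnyP.lookup-index p∈𝒫
    q : Fin (length 𝒫) → Pl
    q k = if does (k Fin.≟ k₀) then H else []
    q-term : ∀ k → (q k ⊛ axiom k) ≈P (if does (k Fin.≟ k₀) then H ⊛ axiom k else [])
    q-term k with does (k Fin.≟ k₀)
    ... | true = ≈P-refl
    ... | false = ≈P-refl
    Σ≈Hp : ([] ++ combination q) ≈P (H ⊛ p)
    Σ≈Hp = ≈P-trans (P.sumL-cong (allFin (length 𝒫)) q-term)
           (≈P-trans (P.sumL-delta (length 𝒫) k₀ (λ k → H ⊛ axiom k)) (≈P-reflexive (≡.cong (H ⊛_) (≡.sym p≡axiom))))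
    deg : ∀ k → DegLE R (q k ⊛ axiom k) d
    deg k with k Fin.≟ k₀
    ... | yes ≡.refl = ≡.subst (λ z → DegLE R (H ⊛ z) d) p≡axiom Hp≤d
    ... | no _ = DegLE-[]

  ≡-× : ∀ {d F G} k → F ≡[ d ] G → (k P.× F) ≡[ d ] (k P.× G)
  ≡-× zero F≡G = ≡-refl []
  ≡-× (suc k) F≡G = ≡-+ F≡G (≡-× k F≡G)

  ≡-sumL : ∀ {x} {X : Set x} {d} (Ls : List X) (f g : X → Pl) → (∀ l → l ∈ Ls → f l ≡[ d ] g l) →
    P.sumL Ls f ≡[ d ] P.sumL Ls g
  ≡-sumL [] f g h = ≡-refl []
  ≡-sumL (l ∷ Ls) f g h = ≡-+ (h l (here ≡.refl)) (≡-sumL Ls f g (λ l′ l′∈ → h l′ (there l′∈)))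

module MatchingAxioms {c ℓ} (R : CommutativeRing c ℓ) (n : ℕ) where
  open CommutativeRing R
  open Polynomials R n
  open Derivations R n (Q R n) public

  X : Fin n → Fin n → Pl
  X = x R

  colSum : Fin n → Pl
  colSum c = sumₚ R (map (λ i → X i c) (allFin n))

  -- The first four families of axioms, in the order in which Q lists them;
  -- the idempotence axioms x² − x come last.
  Columns Rows RowPairs ColumnPairs : List Pl
  Columns = map (λ j → sumₚ R (map (λ i → x R i j) (allFin n)) ++ (-ₚ_ R (constₚ R 1#))) (allFin n)
  Rows = map (λ i → sumₚ R (map (λ j → x R i j) (allFin n)) ++ (-ₚ_ R (constₚ R 1#))) (allFin n)
  RowPairs = concatMap (λ i → concatMap (λ j → map (λ l → x R i j ⊛ x R i l)
                (filter (λ l → ¬? (j Fin.≟ l)) (allFin n))) (allFin n)) (allFin n)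
  ColumnPairs = concatMap (λ j → concatMap (λ i → map (λ l → x R i j ⊛ x R l j)
                  (filter (λ l → ¬? (i Fin.≟ l)) (allFin n))) (allFin n)) (allFin n)

  column∈Q : ∀ c → (colSum c ++ (-ₚ_ R (constₚ R 1#))) ∈ Q R n
  column∈Q c = ∈-++⁺ˡ (∈-map⁺ (λ j → colSum j ++ (-ₚ_ R (constₚ R 1#))) (∈-allFin c))

  rowPair∈Q : ∀ i j l → j ≢ l → (X i j ⊛ X i l) ∈ Q R n
  rowPair∈Q i j l j≢l = ∈-++⁺ʳ Columns (∈-++⁺ʳ Rows (∈-++⁺ˡ
    (∈-concatMap⁺ row (lose (∈-allFin i) (∈-concatMap⁺ (entry i) (lose (∈-allFin j)
      (∈-map⁺ (λ l → X i j ⊛ X i l) (∈-filter⁺ (λ l → ¬? (j Fin.≟ l)) (∈-allFin l) j≢l))))))))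
    where
    entry : Fin n → Fin n → List Pl
    entry i j = map (λ l → X i j ⊛ X i l) (filter (λ l → ¬? (j Fin.≟ l)) (allFin n))
    row : Fin n → List Pl
    row i = concatMap (entry i) (allFin n)

  columnPair∈Q : ∀ i l j → i ≢ l → (X i j ⊛ X l j) ∈ Q R n
  columnPair∈Q i l j i≢l = ∈-++⁺ʳ Columns (∈-++⁺ʳ Rows (∈-++⁺ʳ RowPairs (∈-++⁺ˡ
    (∈-concatMap⁺ column (lose (∈-allFin j) (∈-concatMap⁺ (entry j) (lose (∈-allFin i)
      (∈-map⁺ (λ l → X i j ⊛ X l j) (∈-filter⁺ (λ l → ¬? (i Fin.≟ l)) (∈-allFin l) i≢l)))))))))
    where
    entry : Fin n → Fin n → List Pl
    entry j i = map (λ l → X i j ⊛ X l j) (filter (λ l → ¬? (i Fin.≟ l)) (allFin n))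
    column : Fin n → List Pl
    column j = concatMap (entry j) (allFin n)

  idempotent∈Q : ∀ i j → ((X i j ⊛ X i j) ++ (-ₚ_ R (X i j))) ∈ Q R n
  idempotent∈Q i j = ∈-++⁺ʳ Columns (∈-++⁺ʳ Rows (∈-++⁺ʳ RowPairs (∈-++⁺ʳ ColumnPairs
    (∈-concatMap⁺ (λ i → map (λ j → (X i j ⊛ X i j) ++ (-ₚ_ R (X i j))) (allFin n)) (lose (∈-allFin i)
      (∈-map⁺ (λ j → (X i j ⊛ X i j) ++ (-ₚ_ R (X i j))) (∈-allFin j)))))))

  AllDeg≤-xx : ∀ i j i′ j′ → AllDeg≤ (X i j ⊛ X i′ j′) 2
  AllDeg≤-xx i j i′ j′ = AllDeg≤-⊛ (AllDeg≤-x i j) (AllDeg≤-x i′ j′)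

  quadratic-kills : ∀ {d r} (H g : Pl) → g ∈ Q R n → AllDeg≤ H r → AllDeg≤ g 2 → r ℕ.+ 2 ℕ.≤ d → (H ⊛ g) ≡[ d ] []
  quadratic-kills H g g∈Q H≤r g≤2 r+2≤d = axiom-multiple g g∈Q H (AllDeg≤⇒DegLE (AllDeg≤-mono r+2≤d (AllDeg≤-⊛ H≤r g≤2)))

  idempotent : ∀ {d r} i j (H : Pl) → AllDeg≤ H r → r ℕ.+ 2 ℕ.≤ d → (X i j ⊛ (X i j ⊛ H)) ≡[ d ] (X i j ⊛ H)
  idempotent i j H H≤r r+2≤d =
    ≡-respects xxH≈ (≡-+ (quadratic-kills H g (idempotent∈Q i j) H≤r g≤2 r+2≤d) (≡-refl (H ⊛ X i j))) (⊛-comm H (X i j))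
    where
    xx g : Pl
    xx = X i j ⊛ X i j
    g = xx ++ (-ₚ_ R (X i j))
    g≤2 : AllDeg≤ g 2
    g≤2 = AllDeg≤-++ (AllDeg≤-xx i j i j) (AllDeg≤-neg (AllDeg≤-mono (ℕ.s≤s ℕ.z≤n) (AllDeg≤-x i j)))
    xxH≈ : (X i j ⊛ (X i j ⊛ H)) ≈P ((H ⊛ g) ++ (H ⊛ X i j))
    xxH≈ = ≈P-trans (⊛-rotate (X i j) (X i j) H) (≈P-sym (≈P-trans
             (++-cong (≈P-trans (⊛-distribˡ H xx (-ₚ_ R (X i j))) (++-cong ≈P-refl (⊛-negʳ H (X i j)))) ≈P-refl)
             (sub-add (H ⊛ xx) (H ⊛ X i j))))

  column-one : ∀ c → colSum c ≡[ 1 ] constₚ R 1#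
  column-one c = ≡-respects split
    (≡-+ (≡-refl (constₚ R 1#)) (axiom-multiple g (column∈Q c) (constₚ R 1#)
           (AllDeg≤⇒DegLE (AllDeg≤-⊛ (AllDeg≤-const 1# 0) g≤1))))
    (++-identityʳ _)
    where
    g : Pl
    g = colSum c ++ (-ₚ_ R (constₚ R 1#))
    g≤1 : AllDeg≤ g 1
    g≤1 = AllDeg≤-++ (≡.subst (λ z → AllDeg≤ z 1) (≡.sym (sumₚ-sumL (allFin n) (λ i → X i c)))
                       (AllDeg≤-sumL (allFin n) _ 1 (λ i → AllDeg≤-x i c)))
                     (AllDeg≤-neg (AllDeg≤-const 1# 1))
    split : colSum c ≈P (constₚ R 1# ++ (constₚ R 1# ⊛ g))
    split = ≈P-trans (≈P-sym (≈P-trans (++-comm (constₚ R 1#) g) (sub-add (colSum c) (constₚ R 1#))))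
              (++-cong (≈P-refl {constₚ R 1#}) (≈P-sym (⊛-identityˡ g)))

Distinct : ∀ {n} → List (Fin n) → Set
Distinct = AllPairs _≢_

-- Partial matchings of k rows into the n columns: M i = just j says that
-- row i is matched to column j, and distinct rows get distinct columns.
module Matchings (n : ℕ) where
  open Monomials n using (Word)

  Matching : ℕ → Set
  Matching k = Vec (Maybe (Fin n)) k

  IsMatching : ∀ {k} → Matching k → Set
  IsMatching M = ∀ i i′ j → lookup M i ≡ just j → lookup M i′ ≡ just j → i ≡ i′

  matchedWord : ∀ {k} → Matching k → Vec (Fin n) k → Word
  matchedWord Vec.[] Vec.[] = []
  matchedWord (nothing Vec.∷ M) (s Vec.∷ σ) = matchedWord M σ
  matchedWord (just j Vec.∷ M) (s Vec.∷ σ) = (s , j) ∷ matchedWord M σ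

  size : ∀ {k} → Matching k → ℕ
  size Vec.[] = 0
  size (nothing Vec.∷ M) = size M
  size (just j Vec.∷ M) = suc (size M)

  length-matchedWord : ∀ {k} (M : Matching k) σ → length (matchedWord M σ) ≡ size M
  length-matchedWord Vec.[] Vec.[] = ≡.refl
  length-matchedWord (nothing Vec.∷ M) (s Vec.∷ σ) = length-matchedWord M σ
  length-matchedWord (just j Vec.∷ M) (s Vec.∷ σ) = ≡.cong suc (length-matchedWord M σ)

  empty : ∀ k → Matching k
  empty k = Vec.replicate k nothing

  matchedWord-empty : ∀ {k} (σ : Vec (Fin n) k) → matchedWord (empty k) σ ≡ []
  matchedWord-empty Vec.[] = ≡.refl
  matchedWord-empty (s Vec.∷ σ) = matchedWord-empty σ

  size-empty : ∀ k → size (empty k) ≡ 0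
  size-empty zero = ≡.refl
  size-empty (suc k) = size-empty k

  isMatching-empty : ∀ {k} → IsMatching (empty k)
  isMatching-empty i i′ j M[i]≡j _ with ≡.trans (≡.sym (VP.lookup-replicate i nothing)) M[i]≡j
  ... | ()

  isMatching-tail : ∀ {k} {m} {M : Matching k} → IsMatching (m Vec.∷ M) → IsMatching M
  isMatching-tail isM i i′ j M[i]≡j M[i′]≡j = FinP.suc-injective (isM (Fin.suc i) (Fin.suc i′) j M[i]≡j M[i′]≡j)

  size-unmatch : ∀ {k} (M : Matching k) i j → lookup M i ≡ just j → size M ≡ suc (size (M [ i ]≔ nothing))
  size-unmatch (just j Vec.∷ M) Fin.zero .j ≡.refl = ≡.refl
  size-unmatch (nothing Vec.∷ M) (Fin.suc i) j M[i]≡j = size-unmatch M i j M[i]≡j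
  size-unmatch (just j₀ Vec.∷ M) (Fin.suc i) j M[i]≡j = ≡.cong suc (size-unmatch M i j M[i]≡j)

  isMatching-match : ∀ {k} (M : Matching k) i j → IsMatching M → (∀ i′ → lookup M i′ ≢ just j) →
    IsMatching (M [ i ]≔ just j)
  isMatching-match M i j isM j-free i₁ i₂ j′ e₁ e₂ with i₁ Fin.≟ i | i₂ Fin.≟ i
  ... | yes ≡.refl | yes ≡.refl = ≡.refl
  ... | yes ≡.refl | no i₂≢i = ⊥-elim (j-free i₂ (≡.trans (≡.sym (VP.lookup∘update′ i₂≢i M (just j)))
                                   (≡.trans e₂ (≡.trans (≡.sym e₁) (VP.lookup∘update i M (just j))))))
  ... | no i₁≢i | yes ≡.refl = ⊥-elim (j-free i₁ (≡.trans (≡.sym (VP.lookup∘update′ i₁≢i M (just j)))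
                                   (≡.trans e₁ (≡.trans (≡.sym e₂) (VP.lookup∘update i M (just j))))))
  ... | no i₁≢i | no i₂≢i = isM i₁ i₂ j′ (≡.trans (≡.sym (VP.lookup∘update′ i₁≢i M (just j))) e₁)
                                          (≡.trans (≡.sym (VP.lookup∘update′ i₂≢i M (just j))) e₂)

  matchedLabels : ∀ {k} (M : Matching k) → Vec (Fin n) k → Vec (Fin n) (size M)
  matchedLabels Vec.[] Vec.[] = Vec.[]
  matchedLabels (nothing Vec.∷ M) (s Vec.∷ σ) = matchedLabels M σ
  matchedLabels (just j Vec.∷ M) (s Vec.∷ σ) = s Vec.∷ matchedLabels M σ

  matchedColumns : ∀ {k} (M : Matching k) → Vec (Fin n) (size M)
  matchedColumns Vec.[] = Vec.[]
  matchedColumns (nothing Vec.∷ M) = matchedColumns M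
  matchedColumns (just j Vec.∷ M) = j Vec.∷ matchedColumns M

  zipWord : ∀ {k} → Vec (Fin n) k → Vec (Fin n) k → Word
  zipWord Vec.[] Vec.[] = []
  zipWord (s Vec.∷ τ) (c Vec.∷ cs) = (s , c) ∷ zipWord τ cs

  matchedWord-zip : ∀ {k} (M : Matching k) σ → matchedWord M σ ≡ zipWord (matchedLabels M σ) (matchedColumns M)
  matchedWord-zip Vec.[] Vec.[] = ≡.refl
  matchedWord-zip (nothing Vec.∷ M) (s Vec.∷ σ) = matchedWord-zip M σ
  matchedWord-zip (just j Vec.∷ M) (s Vec.∷ σ) = ≡.cong ((s , j) ∷_) (matchedWord-zip M σ)

  column-row : ∀ {k} (M : Matching k) {j} → j ∈ Vec.toList (matchedColumns M) → ∃ λ i → lookup M i ≡ just j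
  column-row (nothing Vec.∷ M) j∈ with column-row M j∈
  ... | i , M[i]≡j = Fin.suc i , M[i]≡j
  column-row (just j Vec.∷ M) (here ≡.refl) = Fin.zero , ≡.refl
  column-row (just j Vec.∷ M) (there j∈) with column-row M j∈
  ... | i , M[i]≡j = Fin.suc i , M[i]≡j

  matchedColumns-distinct : ∀ {k} (M : Matching k) → IsMatching M → Distinct (Vec.toList (matchedColumns M))
  matchedColumns-distinct Vec.[] _ = AP.[]
  matchedColumns-distinct (nothing Vec.∷ M) isM = matchedColumns-distinct M (isMatching-tail isM)
  matchedColumns-distinct (just j Vec.∷ M) isM =
    All.tabulate (λ j′∈ j≡j′ → j-unused j′∈ j≡j′) AP.∷ matchedColumns-distinct M (isMatching-tail isM)
    where
    j-unused : ∀ {j′} → j′ ∈ Vec.toList (matchedColumns M) → j ≢ j′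
    j-unused j′∈ ≡.refl with column-row M j′∈
    ... | i , M[i]≡j with isM Fin.zero (Fin.suc i) j ≡.refl M[i]≡j
    ... | ()

  -- The number of ways to give the unmatched rows of M distinct labels
  -- avoiding s labels already used and the labels of the matched rows.
  fillings : ∀ {k} → Matching k → ℕ → ℕ
  fillings Vec.[] s = 1
  fillings (just j Vec.∷ M) s = fillings M (suc s)
  fillings (nothing Vec.∷ M) s = fillings M (suc s) ℕ.* (n ℕ.∸ (s ℕ.+ size M))

-- Using x² = x, x_{ij}x_{il} = 0
-- (j ≠ l) and x_{ij}x_{lj} = 0 (i ≠ l), the word σ·w (rows relabelled by an
-- injective σ) either reduces to 0, or to the product over a partial
-- matching M; the outcome depends on w only, not on σ.
module WordReduction {c ℓ} (R : CommutativeRing c ℓ) (n : ℕ) where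
  open CommutativeRing R
  open Monomials n
  open Polynomials R n
  open MatchingAxioms R n
  open Matchings n

  wordPoly : Word → Pl
  wordPoly [] = constₚ R 1#
  wordPoly ((i , j) ∷ w) = X i j ⊛ wordPoly w

  wordPoly-single : ∀ w → wordPoly w ≈P ((1# , ⟦ w ⟧) ∷ [])
  wordPoly-single [] = ≈P-refl
  wordPoly-single ((i , j) ∷ w) = ≈P-trans (⊛-congʳ (X i j) (wordPoly-single w))
    (≈P-trans (single-⊛ (1# , varMon i j) (1# , ⟦ w ⟧)) (single-cong (*-identityˡ 1#) ≡.refl))

  AllDeg≤-wordPoly : ∀ w → AllDeg≤ (wordPoly w) (length w)
  AllDeg≤-wordPoly [] = AllDeg≤-const 1# 0
  AllDeg≤-wordPoly ((i , j) ∷ w) = AllDeg≤-⊛ (AllDeg≤-x i j) (AllDeg≤-wordPoly w)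

  extract : ∀ {k} (M : Matching k) σ i j → lookup M i ≡ just j →
    wordPoly (matchedWord M σ) ≈P X (lookup σ i) j ⊛ wordPoly (matchedWord (M [ i ]≔ nothing) σ)
  extract (just j Vec.∷ M) (s Vec.∷ σ) Fin.zero .j ≡.refl = ≈P-refl
  extract (nothing Vec.∷ M) (s Vec.∷ σ) (Fin.suc i) j M[i]≡j = extract M σ i j M[i]≡j
  extract (just j₀ Vec.∷ M) (s Vec.∷ σ) (Fin.suc i) j M[i]≡j =
    ≈P-trans (⊛-congʳ (X s j₀) (extract M σ i j M[i]≡j)) (⊛-swapˡ (X s j₀) (X (lookup σ i) j) _)

  InjectiveLabelling : Vec (Fin n) n → Set
  InjectiveLabelling σ = Injective _≡_ _≡_ (lookup σ)

  data Reduced (w : Word) : Set (c ⊔ ℓ) where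
    vanishes : (∀ σ → InjectiveLabelling σ → wordPoly (renameWord σ w) ≡[ length w ] []) → Reduced w
    matched : (M : Matching n) → IsMatching M → size M ℕ.≤ length w →
              (∀ σ → InjectiveLabelling σ → wordPoly (renameWord σ w) ≡[ length w ] wordPoly (matchedWord M σ)) →
              Reduced w

  module _ (i j : Fin n) (w : Word) (M : Matching n) (isM : IsMatching M) (size≤ : size M ℕ.≤ length w)
           (w≡M : ∀ σ → InjectiveLabelling σ → wordPoly (renameWord σ w) ≡[ length w ] wordPoly (matchedWord M σ)) where

    private
      rest : Fin n → Vec (Fin n) n → Pl
      rest i′ σ = wordPoly (matchedWord (M [ i′ ]≔ nothing) σ)

      AllDeg≤-rest : ∀ i′ σ → AllDeg≤ (rest i′ σ) (length (matchedWord (M [ i′ ]≔ nothing) σ))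
      AllDeg≤-rest i′ σ = AllDeg≤-wordPoly (matchedWord (M [ i′ ]≔ nothing) σ)

      -- Removing a matched row leaves room for a quadratic factor.
      rest+2≤ : ∀ σ i′ j′ → lookup M i′ ≡ just j′ → length (matchedWord (M [ i′ ]≔ nothing) σ) ℕ.+ 2 ℕ.≤ suc (length w)
      rest+2≤ σ i′ j′ M[i′]≡j′ = ℕP.≤-trans (ℕP.≤-reflexive (ℕP.+-comm _ 2)) (ℕ.s≤s
        (ℕP.≤-trans (ℕP.≤-reflexive (≡.trans (≡.cong suc (length-matchedWord (M [ i′ ]≔ nothing) σ))
                                             (≡.sym (size-unmatch M i′ j′ M[i′]≡j′)))) size≤))

      prepend : ∀ σ → InjectiveLabelling σ →
        wordPoly (renameWord σ ((i , j) ∷ w)) ≡[ suc (length w) ] X (lookup σ i) j ⊛ wordPoly (matchedWord M σ)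
      prepend σ inj = ≡-⊛ (X (lookup σ i) j) (AllDeg≤-x _ _) (w≡M σ inj)

    -- Row i is already matched to column j: the letter is absorbed by x² = x.
    same-column : lookup M i ≡ just j → Reduced ((i , j) ∷ w)
    same-column M[i]≡j = matched M isM (ℕP.m≤n⇒m≤1+n size≤) λ σ inj → ≡-trans (prepend σ inj)
      (≡-respects (⊛-congʳ (X (lookup σ i) j) (extract M σ i j M[i]≡j))
                  (idempotent (lookup σ i) j (rest i σ) (AllDeg≤-rest i σ) (rest+2≤ σ i j M[i]≡j))
                  (≈P-sym (extract M σ i j M[i]≡j)))

    -- Row i is matched to another column j′: x_{σi j} x_{σi j′} = 0.
    other-column : ∀ j′ → lookup M i ≡ just j′ → j′ ≢ j → Reduced ((i , j) ∷ w)
    other-column j′ M[i]≡j′ j′≢j = vanishes λ σ inj → ≡-trans (prepend σ inj)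
      (≡-respects (≈P-trans (⊛-congʳ (X (lookup σ i) j) (extract M σ i j′ M[i]≡j′))
                            (⊛-rotate (X (lookup σ i) j) (X (lookup σ i) j′) _))
                  (quadratic-kills (rest i σ) _ (rowPair∈Q (lookup σ i) j j′ (j′≢j ∘ ≡.sym)) (AllDeg≤-rest i σ)
                                   (AllDeg≤-xx _ _ _ _) (rest+2≤ σ i j′ M[i]≡j′))
                  ≈P-refl)

    -- Row i is unmatched but column j is taken by row i′ ≠ i: x_{σi j} x_{σi′ j} = 0.
    column-taken : lookup M i ≡ nothing → ∀ i′ → lookup M i′ ≡ just j → Reduced ((i , j) ∷ w)
    column-taken M[i]≡∅ i′ M[i′]≡j = vanishes λ σ inj → ≡-trans (prepend σ inj)
      (≡-respects (≈P-trans (⊛-congʳ (X (lookup σ i) j) (extract M σ i′ j M[i′]≡j))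
                            (⊛-rotate (X (lookup σ i) j) (X (lookup σ i′) j) _))
                  (quadratic-kills (rest i′ σ) _ (columnPair∈Q (lookup σ i) (lookup σ i′) j (i≢i′ ∘ inj))
                                   (AllDeg≤-rest i′ σ) (AllDeg≤-xx _ _ _ _) (rest+2≤ σ i′ j M[i′]≡j))
                  ≈P-refl)
      where
      i≢i′ : i ≢ i′
      i≢i′ ≡.refl with ≡.trans (≡.sym M[i]≡∅) M[i′]≡j
      ... | ()

    fresh : lookup M i ≡ nothing → (∀ i′ → lookup M i′ ≢ just j) → Reduced ((i , j) ∷ w)
    fresh M[i]≡∅ j-free = matched M′ (isMatching-match M i j isM j-free) size′≤ λ σ inj → ≡-trans (prepend σ inj)
      (≡-respects ≈P-refl (≡-refl _)
        (≈P-sym (≡.subst (λ z → wordPoly (matchedWord M′ σ) ≈P X (lookup σ i) j ⊛ wordPoly (matchedWord z σ))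
                         unmatch-M′ (extract M′ σ i j M′[i]≡j))))
      where
      M′ : Matching n
      M′ = M [ i ]≔ just j
      M′[i]≡j : lookup M′ i ≡ just j
      M′[i]≡j = VP.lookup∘update i M (just j)
      unmatch-M′ : M′ [ i ]≔ nothing ≡ M
      unmatch-M′ = ≡.trans (VP.[]≔-idempotent M i) (≡.trans (≡.cong (M [ i ]≔_) (≡.sym M[i]≡∅)) (VP.[]≔-lookup M i))
      size′≤ : size M′ ℕ.≤ suc (length w)
      size′≤ = ≡.subst (ℕ._≤ suc (length w)) (≡.sym (≡.trans (size-unmatch M′ i j M′[i]≡j) (≡.cong (suc ∘ size) unmatch-M′)))
                       (ℕ.s≤s size≤)

  reduce : ∀ w → Reduced w
  reduce [] = matched (empty n) isMatching-empty (ℕP.≤-reflexive (size-empty n))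
    (λ σ _ → ≡.subst (λ z → constₚ R 1# ≡[ 0 ] wordPoly z) (≡.sym (matchedWord-empty σ)) (≡-refl _))
  reduce ((i , j) ∷ w) with reduce w
  ... | vanishes w≡0 = vanishes λ σ inj →
          ≡-respects ≈P-refl (≡-⊛ (X (lookup σ i) j) (AllDeg≤-x _ _) (w≡0 σ inj)) (⊛-zeroʳ (X (lookup σ i) j))
  ... | matched M isM size≤ w≡M = by-row-status (lookup M i) ≡.refl
    where
    by-row-status : ∀ v → lookup M i ≡ v → Reduced ((i , j) ∷ w)
    by-row-status (just j′) M[i]≡j′ with j′ Fin.≟ j
    ... | yes ≡.refl = same-column i j w M isM size≤ w≡M M[i]≡j′
    ... | no j′≢j = other-column i j w M isM size≤ w≡M j′ M[i]≡j′ j′≢j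
    by-row-status nothing M[i]≡∅ with FinP.any? (λ i′ → MaybeP.≡-dec Fin._≟_ (lookup M i′) (just j))
    ... | yes (i′ , M[i′]≡j) = column-taken i j w M isM size≤ w≡M M[i]≡∅ i′ M[i′]≡j
    ... | no j-free = fresh i j w M isM size≤ w≡M M[i]≡∅ (λ i′ M[i′]≡j → j-free (i′ , M[i′]≡j))

module Complements (n : ℕ) where
  open import Data.List.Membership.DecPropositional (Fin._≟_ {n}) using (_∈?_)
  module N = ListSums ℕP.+-0-commutativeMonoid

  outside : List (Fin n) → ℕ
  outside Y = length (filter (λ i → ¬? (i ∈? Y)) (allFin n))

  private
    indicator : Bool → ℕ
    indicator b = if b then 1 else 0

    length-filter : ∀ {A : Set} {P : A → Set} (P? : ∀ a → Dec (P a)) xs →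
      length (filter P? xs) ≡ N.sumL xs (λ z → indicator (does (P? z)))
    length-filter P? [] = ≡.refl
    length-filter P? (z ∷ xs) with does (P? z)
    ... | true = ≡.cong suc (length-filter P? xs)
    ... | false = length-filter P? xs

    outside-cons-pt : ∀ y Y → y ∉ Y → ∀ i →
      indicator (does (¬? (i ∈? Y))) ≡ indicator (does (¬? (i ∈? (y ∷ Y)))) ℕ.+ (if does (i Fin.≟ y) then 1 else 0)
    outside-cons-pt y Y y∉Y i with i Fin.≟ y
    ... | yes ≡.refl rewrite dec-false (i ∈? Y) y∉Y = ≡.refl
    ... | no _ = ≡.sym (ℕP.+-identityʳ _)

    outside-cons : ∀ y Y → y ∉ Y → outside Y ≡ outside (y ∷ Y) ℕ.+ 1
    outside-cons y Y y∉Y = begin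
      outside Y
        ≡⟨ length-filter (λ i → ¬? (i ∈? Y)) (allFin n) ⟩
      N.sumL (allFin n) (λ i → indicator (does (¬? (i ∈? Y))))
        ≡⟨ N.sumL-cong (allFin n) (outside-cons-pt y Y y∉Y) ⟩
      N.sumL (allFin n) (λ i → indicator (does (¬? (i ∈? (y ∷ Y)))) ℕ.+ (if does (i Fin.≟ y) then 1 else 0))
        ≡⟨ N.sumL-∙ (allFin n) _ _ ⟩
      N.sumL (allFin n) (λ i → indicator (does (¬? (i ∈? (y ∷ Y))))) ℕ.+ N.sumL (allFin n) (λ i → if does (i Fin.≟ y) then 1 else 0)
        ≡⟨ ≡.cong₂ ℕ._+_ (≡.sym (length-filter (λ i → ¬? (i ∈? (y ∷ Y))) (allFin n))) (N.sumL-delta n y (λ _ → 1)) ⟩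
      outside (y ∷ Y) ℕ.+ 1 ∎
      where open ≡.≡-Reasoning

    outside+length : ∀ Y → Distinct Y → outside Y ℕ.+ length Y ≡ n
    outside+length [] _ = ≡.trans (ℕP.+-identityʳ _) (≡.trans (length-filter (λ i → ¬? (i ∈? [])) (allFin n))
                            (≡.trans (N.sumL-tabulate n id _) (all-ones n)))
      where
      all-ones : ∀ m → N.sum {m} (λ _ → 1) ≡ m
      all-ones zero = ≡.refl
      all-ones (suc m) = ≡.cong suc (all-ones m)
    outside+length (y ∷ Y) (y∉ AP.∷ distinctY) = begin
      outside (y ∷ Y) ℕ.+ suc (length Y)   ≡⟨ ≡.sym (ℕP.+-assoc (outside (y ∷ Y)) 1 (length Y)) ⟩
      (outside (y ∷ Y) ℕ.+ 1) ℕ.+ length Y ≡⟨ ≡.cong (ℕ._+ length Y) (≡.sym (outside-cons y Y (λ y∈Y → All.lookup y∉ y∈Y ≡.refl))) ⟩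
      outside Y ℕ.+ length Y               ≡⟨ outside+length Y distinctY ⟩
      n ∎
      where open ≡.≡-Reasoning

  outside-distinct : ∀ Y → Distinct Y → outside Y ≡ n ℕ.∸ length Y
  outside-distinct Y distinctY =
    ≡.trans (≡.sym (ℕP.m+n∸n≡m (outside Y) (length Y))) (≡.cong (ℕ._∸ length Y) (outside+length Y distinctY))

module FreshSums {a b} (M : CommutativeMonoid a b) (n : ℕ) where
  open import Data.Product using (_×_)
  open CommutativeMonoid M
  open ListSums M renaming (_×_ to _×ₘ_)
  open Complements n
  open Matchings n using (Matching; size; matchedLabels; fillings)
  open import Data.List.Membership.DecPropositional (Fin._≟_ {n}) using (_∈?_)
  open import Relation.Binary.Reasoning.Setoid setoid

  Fresh : List (Fin n) → ∀ {k} → Vec (Fin n) k → Set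
  Fresh X v = Distinct (toList v) × All (_∉ X) (toList v)

  -- Kept abstract: only the fact that it decides Fresh is used.
  abstract
    fresh? : ∀ X {k} (v : Vec (Fin n) k) → Dec (Fresh X v)
    fresh? X v = allPairs? (λ a b → ¬? (a Fin.≟ b)) (toList v) ×-dec all? (λ a → ¬? (a ∈? X)) (toList v)

  sumFresh : ∀ k → List (Fin n) → (Vec (Fin n) k → Carrier) → Carrier
  sumFresh k X g = sumL (allVecs n k) (λ v → if does (fresh? X v) then g v else ε)

  unless : Bool → Carrier → Carrier
  unless c y = if c then ε else y

  unless-ε : ∀ c → unless c ε ≈ ε
  unless-ε true = refl
  unless-ε false = refl

  unless-cong : ∀ c {y z} → y ≈ z → unless c y ≈ unless c z
  unless-cong true _ = refl
  unless-cong false y≈z = y≈z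

  unless-×ₘ : ∀ c k y → unless c (k ×ₘ y) ≈ k ×ₘ unless c y
  unless-×ₘ true k y = sym (×-zero k)
  unless-×ₘ false k y = refl

  sum-Sym : ∀ (g : Vec (Fin n) n → Carrier) → sumL (Sym n) g ≈ sumFresh n [] g
  sum-Sym g = trans (sumL-filter _ (allVecs n n) g) (sumL-cong (allVecs n n) (λ v → reflexive
    (≡.cong (λ z → if z then g v else ε)
      (does-⇔ (mk⇔ (λ distinct → distinct , All.tabulate (λ _ ())) proj₁)
              (allPairs? (λ a b → ¬? (a Fin.≟ b)) (toList v)) (fresh? [] v)))))

  fresh-∷ : ∀ X i {k} (v : Vec (Fin n) k) → i ∉ X → Fresh X (i Vec.∷ v) → Fresh (i ∷ X) v
  fresh-∷ X i v i∉X (i∉v AP.∷ distinct , _ All.∷ v∉X) =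
    distinct , All.zipWith (λ { (i≢a , a∉X) (here a≡i) → i≢a (≡.sym a≡i) ; (i≢a , a∉X) (there a∈X) → a∉X a∈X }) (i∉v , v∉X)

  ∷-fresh : ∀ X i {k} (v : Vec (Fin n) k) → i ∉ X → Fresh (i ∷ X) v → Fresh X (i Vec.∷ v)
  ∷-fresh X i v i∉X (distinct , v∉iX) =
    (All.map (λ a∉iX i≡a → a∉iX (here (≡.sym i≡a))) v∉iX AP.∷ distinct) , (i∉X All.∷ All.map (λ a∉iX a∈X → a∉iX (there a∈X)) v∉iX)

  sumFresh-suc : ∀ k X (g : Vec (Fin n) (suc k) → Carrier) →
    sumFresh (suc k) X g ≈ sumL (allFin n) (λ i → unless (does (i ∈? X)) (sumFresh k (i ∷ X) (λ v → g (i Vec.∷ v))))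
  sumFresh-suc k X g = trans (sumL-concatMap _ (allFin n) _) (sumL-cong (allFin n) (λ i →
    trans (reflexive (sumL-map (i Vec.∷_) (allVecs n k) _)) (first-entry i (i ∈? X))))
    where
    first-entry : ∀ i (i∈?X : Dec (i ∈ X)) →
      sumL (allVecs n k) (λ v → if does (fresh? X (i Vec.∷ v)) then g (i Vec.∷ v) else ε)
        ≈ unless (does i∈?X) (sumFresh k (i ∷ X) (λ v → g (i Vec.∷ v)))
    first-entry i (yes i∈X) = trans (sumL-cong (allVecs n k) (λ v → reflexive (≡.cong (λ z → if z then g (i Vec.∷ v) else ε)
      (dec-false (fresh? X (i Vec.∷ v)) (λ { (_ , i∉X All.∷ _) → i∉X i∈X }))))) (sumL-zero (allVecs n k))
    first-entry i (no i∉X) = sumL-cong (allVecs n k) (λ v → reflexive (≡.cong (λ z → if z then g (i Vec.∷ v) else ε)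
      (does-⇔ (mk⇔ (fresh-∷ X i v i∉X) (∷-fresh X i v i∉X)) (fresh? X (i Vec.∷ v)) (fresh? (i ∷ X) v))))

  private
    fresh-cons : ∀ X i {k} (v : Vec (Fin n) k) y →
      (if does (fresh? (i ∷ X) v) then y else ε) ≈ (if does (fresh? X v) then unless (does (i ∈? toList v)) y else ε)
    fresh-cons X i v y with fresh? X v | i ∈? toList v
    ... | yes (distinct , v∉X) | no i∉v
      rewrite dec-true (fresh? (i ∷ X) v) (distinct , All.tabulate (λ {a} a∈v →
                 λ { (here a≡i) → i∉v (≡.subst (_∈ toList v) a≡i a∈v) ; (there a∈X) → All.lookup v∉X a∈v a∈X })) = refl
    ... | yes _ | yes i∈v rewrite dec-false (fresh? (i ∷ X) v) (λ { (_ , v∉iX) → All.lookup v∉iX i∈v (here ≡.refl) }) = refl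
    ... | no ¬fresh | _ rewrite dec-false (fresh? (i ∷ X) v) (λ { (distinct , v∉iX) → ¬fresh (distinct , All.map (λ a∉iX a∈X → a∉iX (there a∈X)) v∉iX) }) = refl

    unless-∈-++ : ∀ i X T y → unless (does (i ∈? X)) (unless (does (i ∈? T)) y) ≈ unless (does (i ∈? (X ++ T))) y
    unless-∈-++ i X T y with i ∈? X
    ... | yes i∈X rewrite dec-true (i ∈? (X ++ T)) (∈-++⁺ˡ i∈X) = refl
    ... | no i∉X rewrite does-⇔ (mk⇔ (∈-++⁺ʳ X) (λ i∈XT → [ (λ i∈X → ⊥-elim (i∉X i∈X)) , id ]′ (∈-++⁻ X i∈XT))) (i ∈? T) (i ∈? (X ++ T)) = refl

    distinct-++ : ∀ X {k} (v : Vec (Fin n) k) → Distinct X → Fresh X v → Distinct (X ++ toList v)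
    distinct-++ X v distinctX (distinct , v∉X) =
      APP.++⁺ distinctX distinct (All.tabulate (λ {x} x∈X → All.map (λ {a} a∉X x≡a → a∉X (≡.subst (_∈ X) x≡a x∈X)) v∉X))

    sum-outside : ∀ Y y → sumL (allFin n) (λ i → unless (does (i ∈? Y)) y) ≈ outside Y ×ₘ y
    sum-outside Y y = trans (sumL-cong (allFin n) (λ i → negate (i ∈? Y))) (sumL-count (λ i → ¬? (i ∈? Y)) (allFin n) y)
      where
      negate : ∀ {i} (i∈?Y : Dec (i ∈ Y)) → unless (does i∈?Y) y ≈ (if does (¬? i∈?Y) then y else ε)
      negate (yes _) = refl
      negate (no _) = refl

  -- Choosing one more label i that the summand does not see: there are
  -- n − (|X| + k) choices for i once X and the k entries of v are used.
  sumFresh-new : ∀ k X (g : Vec (Fin n) k → Carrier) → Distinct X →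
    sumL (allFin n) (λ i → unless (does (i ∈? X)) (sumFresh k (i ∷ X) g)) ≈ (n ℕ.∸ (length X ℕ.+ k)) ×ₘ sumFresh k X g
  sumFresh-new k X g distinctX = begin
    sumL (allFin n) (λ i → unless (does (i ∈? X)) (sumFresh k (i ∷ X) g))
      ≈⟨ sumL-cong (allFin n) (λ i → unless-cong (does (i ∈? X)) (sumL-cong (allVecs n k) (λ v → fresh-cons X i v (g v)))) ⟩
    sumL (allFin n) (λ i → unless (does (i ∈? X)) (sumL (allVecs n k) (summand i)))
      ≈⟨ sumL-cong (allFin n) (λ i → unless-sumL (does (i ∈? X)) (summand i)) ⟩
    sumL (allFin n) (λ i → sumL (allVecs n k) (λ v → unless (does (i ∈? X)) (summand i v)))
      ≈⟨ sumL-swap (allFin n) (allVecs n k) _ ⟩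
    sumL (allVecs n k) (λ v → sumL (allFin n) (λ i → unless (does (i ∈? X)) (summand i v)))
      ≈⟨ sumL-cong (allVecs n k) (λ v → choices v (fresh? X v)) ⟩
    sumL (allVecs n k) (λ v → c ×ₘ (if does (fresh? X v) then g v else ε))
      ≈⟨ sumL-× (allVecs n k) c _ ⟩
    c ×ₘ sumFresh k X g ∎
    where
    c : ℕ
    c = n ℕ.∸ (length X ℕ.+ k)
    summand : Fin n → Vec (Fin n) k → Carrier
    summand i v = if does (fresh? X v) then unless (does (i ∈? toList v)) (g v) else ε
    unless-sumL : ∀ b (f : Vec (Fin n) k → Carrier) → unless b (sumL (allVecs n k) f) ≈ sumL (allVecs n k) (λ v → unless b (f v))
    unless-sumL true f = sym (sumL-zero (allVecs n k))
    unless-sumL false f = refl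
    choices : ∀ v (d : Dec (Fresh X v)) →
      sumL (allFin n) (λ i → unless (does (i ∈? X)) (if does d then unless (does (i ∈? toList v)) (g v) else ε))
        ≈ c ×ₘ (if does d then g v else ε)
    choices v (yes freshX) = trans (sumL-cong (allFin n) (λ i → unless-∈-++ i X (toList v) (g v)))
      (trans (sum-outside (X ++ toList v) (g v)) (reflexive (≡.cong (_×ₘ g v)
        (≡.trans (outside-distinct (X ++ toList v) (distinct-++ X v distinctX freshX))
                 (≡.cong (n ℕ.∸_) (≡.trans (LP.length-++ X) (≡.cong (length X ℕ.+_) (VP.length-toList v))))))))
    choices v (no _) = trans (sumL-cong (allFin n) (λ i → unless-ε (does (i ∈? X)))) (trans (sumL-zero (allFin n)) (sym (×-zero c)))

  private
    dst-cons : ∀ (X : List (Fin n)) i → Distinct X → i ∉ X → Distinct (i ∷ X)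
    dst-cons X i distinctX i∉X = All.tabulate (λ a∈X i≡a → i∉X (≡.subst (_∈ X) (≡.sym i≡a) a∈X)) AP.∷ distinctX

    unless-dec : ∀ {p} {A : Set p} (d : Dec A) {y z} → (¬ A → y ≈ z) → unless (does d) y ≈ unless (does d) z
    unless-dec (yes _) _ = refl
    unless-dec (no ¬a) y≈z = y≈z ¬a

  sumFresh-matched : ∀ {k} (M : Matching k) (X : List (Fin n)) → Distinct X → (G : Vec (Fin n) (size M) → Carrier) →
    sumFresh k X (λ v → G (matchedLabels M v)) ≈ fillings M (length X) ×ₘ sumFresh (size M) X G
  sumFresh-matched Vec.[] X distinctX G = sym (identityʳ _)
  sumFresh-matched {suc k} (just j Vec.∷ M) X distinctX G = begin
    sumFresh (suc k) X (λ v → G (matchedLabels (just j Vec.∷ M) v))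
      ≈⟨ sumFresh-suc k X _ ⟩
    sumL (allFin n) (λ i → unless (does (i ∈? X)) (sumFresh k (i ∷ X) (λ v → G (i Vec.∷ matchedLabels M v))))
      ≈⟨ sumL-cong (allFin n) (λ i → unless-dec (i ∈? X) (λ i∉X →
           sumFresh-matched M (i ∷ X) (dst-cons X i distinctX i∉X) (λ τ → G (i Vec.∷ τ)))) ⟩
    sumL (allFin n) (λ i → unless (does (i ∈? X)) (F ×ₘ sumFresh (size M) (i ∷ X) (λ τ → G (i Vec.∷ τ))))
      ≈⟨ trans (sumL-cong (allFin n) (λ i → unless-×ₘ (does (i ∈? X)) F _)) (sumL-× (allFin n) F _) ⟩
    F ×ₘ sumL (allFin n) (λ i → unless (does (i ∈? X)) (sumFresh (size M) (i ∷ X) (λ τ → G (i Vec.∷ τ))))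
      ≈⟨ ×-congʳ F (sym (sumFresh-suc (size M) X G)) ⟩
    F ×ₘ sumFresh (suc (size M)) X G ∎
    where
    F : ℕ
    F = fillings M (suc (length X))
  sumFresh-matched {suc k} (nothing Vec.∷ M) X distinctX G = begin
    sumFresh (suc k) X (λ v → G (matchedLabels (nothing Vec.∷ M) v))
      ≈⟨ sumFresh-suc k X _ ⟩
    sumL (allFin n) (λ i → unless (does (i ∈? X)) (sumFresh k (i ∷ X) (λ v → G (matchedLabels M v))))
      ≈⟨ sumL-cong (allFin n) (λ i → unless-dec (i ∈? X) (λ i∉X →
           sumFresh-matched M (i ∷ X) (dst-cons X i distinctX i∉X) G)) ⟩
    sumL (allFin n) (λ i → unless (does (i ∈? X)) (F ×ₘ sumFresh (size M) (i ∷ X) G))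
      ≈⟨ trans (sumL-cong (allFin n) (λ i → unless-×ₘ (does (i ∈? X)) F _)) (sumL-× (allFin n) F _) ⟩
    F ×ₘ sumL (allFin n) (λ i → unless (does (i ∈? X)) (sumFresh (size M) (i ∷ X) G))
      ≈⟨ ×-congʳ F (sumFresh-new (size M) X G distinctX) ⟩
    F ×ₘ ((n ℕ.∸ (length X ℕ.+ size M)) ×ₘ sumFresh (size M) X G)
      ≈⟨ ×-assocˡ _ F _ ⟩
    (F ℕ.* (n ℕ.∸ (length X ℕ.+ size M))) ×ₘ sumFresh (size M) X G ∎
    where
    F : ℕ
    F = fillings M (suc (length X))

-- For distinct columns
-- c₁ … cₖ, the sum over distinct row labels τ ∉ Y of x_{τ₁c₁} ⋯ x_{τₖcₖ}
-- equals the product of the partial column sums Σ_{i ∉ Y} x_{icᵣ}, since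
-- the cross terms with a repeated row vanish by x_{ic}x_{ic′} = 0; for
-- Y = [] each column sum is 1.  Hence Σ_σ (product over M) is the constant
-- fillings M 0, in degree size M.
module MatchingSums {c ℓ} (R : CommutativeRing c ℓ) (n : ℕ) where
  open CommutativeRing R
  open Polynomials R n
  open MatchingAxioms R n
  open Matchings n
  open WordReduction R n
  open FreshSums +P-commutativeMonoid n
  open import Data.List.Membership.DecPropositional (Fin._≟_ {n}) using (_∈?_)

  partialColSum : Fin n → List (Fin n) → Pl
  partialColSum c Y = P.sumL (allFin n) (λ i → unless (does (i ∈? Y)) (X i c))

  colProduct : ∀ {k} → Vec (Fin n) k → List (Fin n) → Pl
  colProduct Vec.[] Y = constₚ R 1#
  colProduct (c Vec.∷ cs) Y = partialColSum c Y ⊛ colProduct cs Y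

  freshProducts : ∀ {k} → Vec (Fin n) k → List (Fin n) → Pl
  freshProducts {k} cs Y = sumFresh k Y (λ τ → wordPoly (zipWord τ cs))

  AllDeg≤-partialColSum : ∀ c Y → AllDeg≤ (partialColSum c Y) 1
  AllDeg≤-partialColSum c Y = AllDeg≤-sumL (allFin n) _ 1 (λ i → unless-deg i (does (i ∈? Y)))
    where
    unless-deg : ∀ i b → AllDeg≤ (unless b (X i c)) 1
    unless-deg i true = All.[]
    unless-deg i false = AllDeg≤-x i c

  AllDeg≤-colProduct : ∀ {k} (cs : Vec (Fin n) k) Y → AllDeg≤ (colProduct cs Y) k
  AllDeg≤-colProduct Vec.[] Y = AllDeg≤-const 1# 0
  AllDeg≤-colProduct (c Vec.∷ cs) Y = AllDeg≤-⊛ (AllDeg≤-partialColSum c Y) (AllDeg≤-colProduct cs Y)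

  unless-⊛ : ∀ b (p q : Pl) → unless b (p ⊛ q) ≈P p ⊛ unless b q
  unless-⊛ true p q = ≈P-sym (⊛-zeroʳ p)
  unless-⊛ false p q = ≈P-refl

  if-⊛ : ∀ b (p q : Pl) → (if b then p ⊛ q else []) ≈P p ⊛ (if b then q else [])
  if-⊛ true p q = ≈P-refl
  if-⊛ false p q = ≈P-sym (⊛-zeroʳ p)

  partialColSum-split : ∀ i c Y → i ∉ Y → partialColSum c Y ≈P (partialColSum c (i ∷ Y) ++ X i c)
  partialColSum-split i c Y i∉Y = ≈P-trans (P.sumL-cong (allFin n) pointwise)
      (≈P-trans (P.sumL-∙ (allFin n) _ _) (++-cong ≈P-refl (P.sumL-delta n i (λ s → X s c))))
    where
    pointwise : ∀ s → unless (does (s ∈? Y)) (X s c) ≈P (unless (does (s ∈? (i ∷ Y))) (X s c) ++ (if does (s Fin.≟ i) then X s c else []))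
    pointwise s with s Fin.≟ i
    ... | yes ≡.refl rewrite dec-false (s ∈? Y) i∉Y = ≈P-refl
    ... | no _ = ≈P-sym (++-identityʳ _)

  -- Once row i is used by x_{ic₀}, row i may as well be allowed again in the
  -- other columns c ≠ c₀: the extra terms x_{ic₀} x_{ic} vanish.
  release-row : ∀ {k} i c₀ (cs : Vec (Fin n) k) Y → i ∉ Y → All (c₀ ≢_) (toList cs) →
    (X i c₀ ⊛ colProduct cs (i ∷ Y)) ≡[ suc k ] (X i c₀ ⊛ colProduct cs Y)
  release-row i c₀ Vec.[] Y i∉Y _ = ≡-refl _
  release-row {suc k} i c₀ (c Vec.∷ cs) Y i∉Y (c₀≢c All.∷ c₀∉cs) = ≡-trans release-tail release-head
    where
    rest colI : Pl
    rest = colProduct cs Y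
    colI = partialColSum c (i ∷ Y)
    release-tail : (X i c₀ ⊛ (colI ⊛ colProduct cs (i ∷ Y))) ≡[ suc (suc k) ] (X i c₀ ⊛ (colI ⊛ rest))
    release-tail = ≡-respects (⊛-swapˡ (X i c₀) colI _)
                     (≡-⊛ colI (AllDeg≤-partialColSum c (i ∷ Y)) (release-row i c₀ cs Y i∉Y c₀∉cs))
                     (⊛-swapˡ colI (X i c₀) rest)
    cross-term : (X i c₀ ⊛ (X i c ⊛ rest)) ≡[ suc (suc k) ] []
    cross-term = ≡-respects (⊛-rotate (X i c₀) (X i c) rest)
      (quadratic-kills rest (X i c₀ ⊛ X i c) (rowPair∈Q i c₀ c c₀≢c) (AllDeg≤-colProduct cs Y) (AllDeg≤-xx i c₀ i c)
                       (ℕP.≤-reflexive (ℕP.+-comm k 2)))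
      ≈P-refl
    release-head : (X i c₀ ⊛ (colI ⊛ rest)) ≡[ suc (suc k) ] (X i c₀ ⊛ (partialColSum c Y ⊛ rest))
    release-head = ≡-respects ≈P-refl (≡-sym (≡-respects
      (≈P-trans (⊛-congʳ (X i c₀) (≈P-trans (⊛-congˡ rest (partialColSum-split i c Y i∉Y)) (⊛-distribʳ colI (X i c) rest)))
                (⊛-distribˡ (X i c₀) (colI ⊛ rest) (X i c ⊛ rest)))
      (≡-+ (≡-refl (X i c₀ ⊛ (colI ⊛ rest))) cross-term)
      (++-identityʳ _))) ≈P-refl

  freshProducts-colProduct : ∀ {k} (cs : Vec (Fin n) k) Y → Distinct (toList cs) → freshProducts cs Y ≡[ k ] colProduct cs Y
  freshProducts-colProduct Vec.[] Y _ = ≡-respects empty-tuple (≡-refl (constₚ R 1#)) ≈P-refl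
    where
    empty-tuple : freshProducts Vec.[] Y ≈P constₚ R 1#
    empty-tuple rewrite dec-true (fresh? Y (Vec.[] {A = Fin n})) (AP.[] , All.[]) = ++-identityʳ _
  freshProducts-colProduct {suc k} (c₀ Vec.∷ cs) Y (c₀∉cs AP.∷ distinct) =
    ≡-respects first-row (≡-sumL (allFin n) _ _ per-row) factor
    where
    first-row : freshProducts (c₀ Vec.∷ cs) Y ≈P P.sumL (allFin n) (λ i → unless (does (i ∈? Y)) (X i c₀ ⊛ freshProducts cs (i ∷ Y)))
    first-row = ≈P-trans (sumFresh-suc k Y _) (P.sumL-cong (allFin n) (λ i → unless-cong (does (i ∈? Y))
      (≈P-trans (P.sumL-cong (allVecs n k) (λ v → if-⊛ (does (fresh? (i ∷ Y) v)) (X i c₀) (wordPoly (zipWord v cs))))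
                (≈P-sym (⊛-sumʳ (X i c₀) (allVecs n k) (λ v → if does (fresh? (i ∷ Y) v) then wordPoly (zipWord v cs) else []))))))
    per-row : ∀ i → i ∈ allFin n →
      unless (does (i ∈? Y)) (X i c₀ ⊛ freshProducts cs (i ∷ Y)) ≡[ suc k ] unless (does (i ∈? Y)) (X i c₀ ⊛ colProduct cs Y)
    per-row i _ with i ∈? Y
    ... | yes _ = ≡-refl []
    ... | no i∉Y = ≡-trans (≡-⊛ (X i c₀) (AllDeg≤-x i c₀) (freshProducts-colProduct cs (i ∷ Y) distinct))
                           (release-row i c₀ cs Y i∉Y c₀∉cs)
    factor : P.sumL (allFin n) (λ i → unless (does (i ∈? Y)) (X i c₀ ⊛ colProduct cs Y)) ≈P colProduct (c₀ Vec.∷ cs) Y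
    factor = ≈P-trans (P.sumL-cong (allFin n) (λ i → unless-cong (does (i ∈? Y)) (⊛-comm (X i c₀) (colProduct cs Y))))
             (≈P-trans (P.sumL-cong (allFin n) (λ i → unless-⊛ (does (i ∈? Y)) (colProduct cs Y) (X i c₀)))
             (≈P-trans (≈P-sym (⊛-sumʳ (colProduct cs Y) (allFin n) (λ i → unless (does (i ∈? Y)) (X i c₀))))
                       (⊛-comm (colProduct cs Y) (partialColSum c₀ Y))))

  colProduct-one : ∀ {k} (cs : Vec (Fin n) k) → colProduct cs [] ≡[ k ] constₚ R 1#
  colProduct-one Vec.[] = ≡-refl _
  colProduct-one {suc k} (c Vec.∷ cs) = ≡-trans first (≡-mono (ℕP.n≤1+n k) (colProduct-one cs))
    where
    rest : Pl
    rest = colProduct cs []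
    full-column : partialColSum c [] ≡[ 1 ] constₚ R 1#
    full-column = ≡-respects (≈P-sym (≈P-reflexive (sumₚ-sumL (allFin n) (λ i → X i c)))) (column-one c) ≈P-refl
    first : (partialColSum c [] ⊛ rest) ≡[ suc k ] rest
    first = ≡-mono (ℕP.≤-reflexive (ℕP.+-comm k 1))
      (≡-respects (⊛-comm (partialColSum c []) rest) (≡-⊛ rest (AllDeg≤-colProduct cs []) full-column)
                  (≈P-trans (⊛-comm rest (constₚ R 1#)) (⊛-identityˡ rest)))

  sum-matchedWord : ∀ (M : Matching n) → IsMatching M →
    P.sumL (Sym n) (λ σ → wordPoly (matchedWord M σ)) ≡[ size M ] constₚ R (fillings M 0 C.× 1#)
  sum-matchedWord M isM = ≡-respects as-fresh-sum
    (≡-× (fillings M 0) (≡-trans (freshProducts-colProduct (matchedColumns M) [] (matchedColumns-distinct M isM))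
                                 (colProduct-one (matchedColumns M))))
    (const-× (fillings M 0) 1#)
    where
    as-fresh-sum : P.sumL (Sym n) (λ σ → wordPoly (matchedWord M σ)) ≈P fillings M 0 P.× freshProducts (matchedColumns M) []
    as-fresh-sum = ≈P-trans (sum-Sym (λ σ → wordPoly (matchedWord M σ)))
      (≈P-trans (P.sumL-cong (allVecs n n) (λ σ → ≈P-reflexive (≡.cong (λ z → if does (fresh? [] σ) then wordPoly z else [])
                                                                    (matchedWord-zip M σ))))
                (sumFresh-matched M [] AP.[] (λ τ → wordPoly (zipWord τ (matchedColumns M)))))

module Symmetrisation {c ℓ} (R : CommutativeRing c ℓ) (n : ℕ) where
  open CommutativeRing R
  open Monomials n
  open Polynomials R n
  open MatchingAxioms R n
  open Matchings n
  open WordReduction R n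
  open MatchingSums R n

  injective-Sym : ∀ σ → σ ∈ Sym n → InjectiveLabelling σ
  injective-Sym σ σ∈Sym = lookup-injective σ (proj₂ (∈-filter⁻ (λ v → allPairs? (λ a b → ¬? (a Fin.≟ b)) (toList v))
                                                               {xs = allVecs n n} σ∈Sym))
    where
    lookup∈ : ∀ {k} (v : Vec (Fin n) k) i → lookup v i ∈ toList v
    lookup∈ (s Vec.∷ v) Fin.zero = here ≡.refl
    lookup∈ (s Vec.∷ v) (Fin.suc i) = there (lookup∈ v i)
    lookup-injective : ∀ {k} (v : Vec (Fin n) k) → Distinct (toList v) → ∀ {i i′} → lookup v i ≡ lookup v i′ → i ≡ i′
    lookup-injective (s Vec.∷ v) _ {Fin.zero} {Fin.zero} _ = ≡.refl
    lookup-injective (s Vec.∷ v) (s∉v AP.∷ _) {Fin.zero} {Fin.suc i′} e = ⊥-elim (All.lookup s∉v (lookup∈ v i′) e)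
    lookup-injective (s Vec.∷ v) (s∉v AP.∷ _) {Fin.suc i} {Fin.zero} e = ⊥-elim (All.lookup s∉v (lookup∈ v i) (≡.sym e))
    lookup-injective (s Vec.∷ v) (_ AP.∷ distinct) {Fin.suc i} {Fin.suc i′} e = ≡.cong Fin.suc (lookup-injective v distinct e)

  act-term : ∀ σ a e → act R σ ((a , e) ∷ []) ≈P constₚ R a ⊛ wordPoly (renameWord σ (word e))
  act-term σ a e = ≈P-sym (≈P-trans (⊛-congʳ (constₚ R a) (wordPoly-single (renameWord σ (word e))))
    (≈P-trans (single-⊛ (a , zeroMon) (1# , ⟦ renameWord σ (word e) ⟧)) (single-cong (*-identityʳ a)
      (≡.trans (·ᴹ-identityˡ _) (≡.trans (≡.sym (rename-⟦⟧ σ (word e))) (≡.cong (renameMon σ) (word-⟦⟧ e)))))))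

  symTerm : Term → Pl
  symTerm t = P.sumL (Sym n) (λ σ → act R σ (t ∷ []))

  outcome : ∀ {w} → Carrier → Reduced w → Carrier
  outcome a (vanishes _) = 0#
  outcome a (matched M _ _ _) = a * (fillings M 0 C.× 1#)

  termConstant : Term → Carrier
  termConstant (a , e) = outcome a (reduce (word e))

  symTerm-constant : ∀ d (t : Term) → totalDeg (proj₂ t) ℕ.≤ d → symTerm t ≡[ d ] constₚ R (termConstant t)
  symTerm-constant d (a , e) e≤d = ≡-mono |w|≤d (by-outcome (reduce w))
    where
    w : Word
    w = word e
    |w|≤d : length w ℕ.≤ d
    |w|≤d = ℕP.≤-trans (ℕP.≤-reflexive (length-word e)) e≤d
    a· : Pl → Pl
    a· = constₚ R a ⊛_
    symmetrised : symTerm (a , e) ≈P a· (P.sumL (Sym n) (λ σ → wordPoly (renameWord σ w)))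
    symmetrised = ≈P-trans (P.sumL-cong (Sym n) (λ σ → act-term σ a e)) (≈P-sym (⊛-sumʳ (constₚ R a) (Sym n) _))
    by-outcome : (r : Reduced w) → symTerm (a , e) ≡[ length w ] constₚ R (outcome a r)
    by-outcome (vanishes w≡0) = ≡-respects symmetrised
      (≡-⊛ (constₚ R a) (AllDeg≤-const a 0) (≡-sumL (Sym n) _ (λ _ → []) (λ σ σ∈ → w≡0 σ (injective-Sym σ σ∈))))
      (≈P-trans (⊛-congʳ (constₚ R a) (P.sumL-zero (Sym n))) (≈P-trans (⊛-zeroʳ (constₚ R a)) const-0))
    by-outcome (matched M isM size≤ w≡M) = ≡-trans
      (≡-respects symmetrised
        (≡-⊛ (constₚ R a) (AllDeg≤-const a 0) (≡-sumL (Sym n) _ _ (λ σ σ∈ → w≡M σ (injective-Sym σ σ∈)))) ≈P-refl)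
      (≡-mono size≤ (≡-respects ≈P-refl (≡-⊛ (constₚ R a) (AllDeg≤-const a 0) (sum-matchedWord M isM))
        (≈P-trans (single-⊛ (a , zeroMon) (fillings M 0 C.× 1# , zeroMon)) (single-cong refl (·ᴹ-identityˡ zeroMon)))))

  lowTerms : ℕ → Pl → Pl
  lowTerms d = filter (λ t → totalDeg (proj₂ t) ℕP.≤? d)

  lowTerms-degree : ∀ {d F t} → t ∈ lowTerms d F → totalDeg (proj₂ t) ℕ.≤ d
  lowTerms-degree {d} {F} t∈ = proj₂ (∈-filter⁻ (λ t → totalDeg (proj₂ t) ℕP.≤? d) {xs = F} t∈)

  lowTerms-≈ : ∀ {F d} → DegLE R F d → F ≈P lowTerms d F
  lowTerms-≈ {F} {d} F≤d = ⟪ (λ m → trans (coeff-sum F m) (trans (C.sumL-partition low? F _) (by-degree m (totalDeg m ℕP.≤? d)))) ⟫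
    where
    low? : (t : Term) → Dec (totalDeg (proj₂ t) ℕ.≤ d)
    low? t = totalDeg (proj₂ t) ℕP.≤? d
    High : Pl
    High = filter (λ t → ¬? (low? t)) F
    high-at-low : ∀ m → totalDeg m ℕ.≤ d → imageCoeff (λ e → e) High m ≈ 0#
    high-at-low m m≤d = trans (C.sumL-cong∈ High (λ t t∈ → reflexive (termCoeff-≢ (proj₁ t) {proj₂ t} {m}
      (λ e≡m → proj₂ (∈-filter⁻ (λ t → ¬? (low? t)) {xs = F} t∈) (≡.subst (λ z → totalDeg z ℕ.≤ d) (≡.sym e≡m) m≤d)))))
      (C.sumL-zero High)
    low-at-high : ∀ m → d ℕ.< totalDeg m → imageCoeff (λ e → e) (lowTerms d F) m ≈ 0#
    low-at-high m d<m = trans (C.sumL-cong∈ (lowTerms d F) (λ t t∈ → reflexive (termCoeff-≢ (proj₁ t) {proj₂ t} {m}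
      (λ e≡m → ℕP.<-irrefl ≡.refl (ℕP.<-≤-trans d<m (≡.subst (λ z → totalDeg z ℕ.≤ d) e≡m (lowTerms-degree {d} {F} t∈)))))))
      (C.sumL-zero (lowTerms d F))
    by-degree : ∀ m → Dec (totalDeg m ℕ.≤ d) →
      (imageCoeff (λ e → e) (lowTerms d F) m + imageCoeff (λ e → e) High m) ≈ coeff R (lowTerms d F) m
    by-degree m (yes m≤d) = trans (+-cong refl (high-at-low m m≤d)) (trans (+-identityʳ _) (sym (coeff-sum (lowTerms d F) m)))
    by-degree m (no m≰d) = trans (sym (C.sumL-partition low? F _)) (trans (sym (coeff-sum F m))
      (trans (F≤d m (ℕP.≰⇒> m≰d)) (sym (trans (coeff-sum (lowTerms d F) m) (low-at-high m (ℕP.≰⇒> m≰d))))))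

  symSum-terms : ∀ {F d} → DegLE R F d → symSum R F ≈P P.sumL (lowTerms d F) symTerm
  symSum-terms {F} {d} F≤d =
    ≈P-trans (≈P-reflexive (sumₚ-sumL (Sym n) (λ σ → act R σ F)))
    (≈P-trans (P.sumL-cong (Sym n) (λ σ → map-cong (renameMon σ) (lowTerms-≈ F≤d)))
    (≈P-trans (P.sumL-cong (Sym n) (λ σ → ≈P-reflexive (act-terms σ (lowTerms d F))))
              (P.sumL-swap (Sym n) (lowTerms d F) (λ σ t → act R σ (t ∷ [])))))
    where
    act-terms : ∀ σ (L : Pl) → act R σ L ≡ P.sumL L (λ t → act R σ (t ∷ []))
    act-terms σ [] = ≡.refl
    act-terms σ (t ∷ L) = ≡.cong (_ ∷_) (act-terms σ L)

mainTheorem16 : ∀ {c ℓ} (R : CommutativeRing c ℓ) (n : ℕ) → 1 ≤ n →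
    (F : Poly R n) (d : ℕ) → IsDegree R F d →
    ∃ λ (cF : CommutativeRing.Carrier R) →
    EquivMod R (Q R n) d (symSum R F) (constₚ R cF)
mainTheorem16 R n _ F d (F≤d , _) =
  C.sumL low termConstant ,
  toEquivMod (≡-respects (symSum-terms F≤d)
                         (≡-sumL low symTerm (λ t → constₚ R (termConstant t)) (λ t t∈ → symTerm-constant d t (lowTerms-degree {d} {F} t∈)))
                         (const-sumL low termConstant))
  where
  open Polynomials R n
  open MatchingAxioms R n
  open Symmetrisation R n
  low : Poly R n
  low = lowTerms d F
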